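{- Let $r\geq 2$. For $\boldsymbol{n}=(n_1,\dots,n_{r-1})\in\mathbb{N}_0^{r-1}$ define \[ \Phi_{\boldsymbol{n}}(z_1,\dots,z_{r-1};q):= \prod_{i=1}^{r-1} \frac{1}{(z_iq)_{n_1-n_{i+1}}}\,{n_i \brack n_{i+1}}, \] and for $\boldsymbol{n},\boldsymbol{m}\in\mathbb{N}_0^{r-1}$ \[ \mathcal{K}_{\boldsymbol{n},\boldsymbol{m}}(z_1,\dots,z_{r-1};q):= {n_1 \brack m_1} \prod_{i=1}^{r-1} z_i^{m_i-m_{i+1}} q^{m_i^2-m_im_{i+1}} {n_1-n_{i+1}-m_1+m_i \brack n_i-n_{i+1}}, \] where $n_r=m_r:=0$. Then for every $\boldsymbol{n}\in\mathbb{N}_0^{r-1}$, \[ \sum_{\boldsymbol{m}\in\mathbb{N}_0^{r-1}} \mathcal{K}_{\boldsymbol{n},\boldsymbol{m}}(z_1,\dots,z_{r-1};q) \Phi_{\boldsymbol{m}}(z_1,\dots,z_{r-1};q) =\Phi_{\boldsymbol{n}}(z_1,\dots,z_{r-1};q). \]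
   Context: For $n\in\mathbb{Z}$, $(x)_n=(x;q)_n:=(x;q)_\infty/(xq^n;q)_\infty$ with $(x;q)_\infty=\prod_{i\ge0}(1-xq^i)$. For $n,m\in\mathbb{Z}$, ${n\brack m}=\frac{(q)_n}{(q)_m(q)_{n-m}}$ if $0\leq m\leq n$ and $0$ otherwise, with $(q)_n=(q;q)_n$. -}

module Defs where

open import Level using (Level; _⊔_)
open import Algebra.Bundles using (CommutativeRing)
open import Data.Nat as ℕ using (ℕ; zero; suc; _≤?_)
open import Data.Integer as ℤ using (ℤ; +_; -[1+_])
open import Data.Fin using (Fin; zero; suc; toℕ)
open import Relation.Nullary using (¬_; yes; no)

-- A field: a commutative ring with 0 ≉ 1 and a (total) inverse
-- operation that is a two-sided inverse on every nonzero element.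
-- (The value of inv 0 is irrelevant/unspecified.)
record Field (c ℓ : Level) : Set (Level.suc (c ⊔ ℓ)) where
  field
    commRing : CommutativeRing c ℓ
  open CommutativeRing commRing public
  field
    inv      : Carrier → Carrier
    inv-cong : ∀ {x y} → x ≈ y → inv x ≈ inv y
    0≉1      : ¬ (0# ≈ 1#)
    inv-r    : ∀ x → ¬ (x ≈ 0#) → x * inv x ≈ 1#

-- 0-based lookup into a vector (Fin s → ℕ), returning 0 out of range.
-- With 1-based paper indexing, n_j = at n (j - 1), and n_r = at n (r - 1) = 0.
at : ∀ {s} → (Fin s → ℕ) → ℕ → ℕ
at {zero}  n j       = 0
at {suc s} n zero    = n zero
at {suc s} n (suc j) = at (λ i → n (suc i)) j

module FieldOps {c ℓ} (F : Field c ℓ) where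
  open Field F public using (Carrier; _≈_; _+_; _*_; _-_; 0#; 1#; inv)

  pow : Carrier → ℕ → Carrier
  pow x zero    = 1#
  pow x (suc n) = pow x n * x

  zpow : Carrier → ℤ → Carrier
  zpow x (+ n)     = pow x n
  zpow x -[1+ n ]  = inv (pow x (suc n))

  poch : Carrier → Carrier → ℕ → Carrier
  poch q x zero    = 1#
  poch q x (suc n) = poch q x n * (1# - x * pow q n)

  -- (x;q)_n for n ∈ ℤ, n = (x;q)_∞/(x q^n;q)_∞;
  -- for n = -k < 0 this is 1/(x q^{-k};q)_k.
  pochℤ : Carrier → Carrier → ℤ → Carrier
  pochℤ q x (+ n)    = poch q x n
  pochℤ q x -[1+ k ] = inv (poch q (x * zpow q -[1+ k ]) (suc k))

  qbinℕ : Carrier → ℕ → ℕ → Carrier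
  qbinℕ q a b with b ≤? a
  ... | yes _ = poch q q a * inv (poch q q b * poch q q (a ℕ.∸ b))
  ... | no  _ = 0#

  qbin : Carrier → ℤ → ℤ → Carrier
  qbin q (+ a)     (+ b)     = qbinℕ q a b
  qbin q (+ a)     -[1+ _ ]  = 0#
  qbin q -[1+ _ ]  _         = 0#

  prodFin : ∀ {s} → (Fin s → Carrier) → Carrier
  prodFin {zero}  f = 1#
  prodFin {suc s} f = f zero * prodFin (λ i → f (suc i))

  sumTo : ℕ → (ℕ → Carrier) → Carrier
  sumTo zero    f = f zero
  sumTo (suc N) f = sumTo N f + f (suc N)

  boxSum : ∀ s → ℕ → ((Fin s → ℕ) → Carrier) → Carrier
  boxSum zero    N f = f (λ ())
  boxSum (suc s) N f =
    sumTo N (λ j → boxSum s N (λ m → f (λ { zero → j ; (suc i) → m i })))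

  -- 1-based index of i : Fin s is toℕ i + 1; "i+1" entry is at n (suc (toℕ i)).
  nxt : ∀ {s} → (Fin s → ℕ) → Fin s → ℕ
  nxt n i = at n (suc (toℕ i))

  Φ : ∀ {s} → (Fin s → Carrier) → Carrier → (Fin s → ℕ) → Carrier
  Φ z q n = prodFin (λ i →
      inv (pochℤ q (z i * q) (+ at n 0 ℤ.- + nxt n i))
    * qbin q (+ n i) (+ nxt n i))

  K : ∀ {s} → (Fin s → Carrier) → Carrier → (Fin s → ℕ) → (Fin s → ℕ) → Carrier
  K z q n m = qbin q (+ at n 0) (+ at m 0) * prodFin (λ i →
      zpow (z i) (+ m i ℤ.- + nxt m i)
    * zpow q (+ m i ℤ.* + m i ℤ.- + m i ℤ.* + nxt m i)
    * qbin q (+ at n 0 ℤ.- + nxt n i ℤ.- + at m 0 ℤ.+ + m i)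
             (+ n i ℤ.- + nxt n i))

-- Induction on r.  Summands K_{n,m} Φ_m vanish unless n and m are weakly
-- decreasing and m₁ ≤ n₁, so write m₁ = m₂ + f.  Then K_{n,m} Φ_m factors as a
-- coefficient depending only on (n, f) times the rank r - 1 summand
-- K_{n′,m′} Φ_{m′}(z′) with n′ = (n₁ - f, n₃, …), m′ = (m₂, m₃, …) and
-- z′ = (z₂ qᶠ, z₃ qᶠ, …); the identity [n₁, m₁][m₁, m₂] = [n₁, f][n₁ - f, m₂]
-- and the splitting (x)_{f+k} = (x)_f (x qᶠ)_k do the work.  Summing over m′ by
-- induction leaves Σ_f coefficient · Φ_{n′}(z′), and a product of three
-- q-binomials rewrites each term as Φ_n [d, f] z₁ᶠ q^{f²} (z₁ q^{f+1})_{d-f} with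
-- d = n₁ - n₂.  That sum over f is 1: Pascal's rule turns the sum for d + 1 with
-- parameter z₁ into the sum for d with parameter z₁ q.

{-# OPTIONS --safe #-}
module Submission where

open import Defs
open import Data.Nat using (ℕ; _≤_; _∸_; suc)
open import Data.Integer using (ℤ; +_; -[1+_]; _⊖_; _◃_)
open import Data.Fin using (Fin; zero; suc; toℕ)
open import Relation.Nullary using (¬_; yes; no)

open import Algebra.Bundles using (CommutativeRing)
open import Data.Empty using (⊥-elim)
open import Data.Maybe using (Maybe; just; nothing)
open import Data.Product using (Σ; _,_; proj₁; proj₂) renaming (_×_ to _∧_)
open import Data.Sum using (_⊎_; inj₁; inj₂)
open import Data.Unit using (⊤; tt)
open import Relation.Binary.Definitions using (tri<; tri≈; tri>)
open import Relation.Binary.PropositionalEquality as ≡ using (_≡_)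
import Algebra.Properties.AbelianGroup as AbelianGroupProperties
import Algebra.Properties.Ring as RingProperties
import Algebra.Properties.Semiring.Mult.TCOptimised as SemiringMultiplication
import Algebra.Solver.Ring as RingSolver
import Algebra.Solver.Ring.AlmostCommutativeRing as ACR
import Data.Integer as ℤ
import Data.Integer.Properties as ℤ
import Data.Integer.Solver as ℤ-Solver
import Data.Nat as ℕ
import Data.Nat.Properties as ℕ
import Data.Nat.Solver as ℕ-Solver
import Data.Sign as Sign
import Data.Vec.Functional as Vector

module _ where
  open ℕ-Solver.+-*-Solver

  square-suc : ∀ f → suc f ℕ.* suc f ≡ f ℕ.* f ℕ.+ (f ℕ.+ suc f)
  square-suc = solve 1 (λ f → (con 1 :+ f) :* (con 1 :+ f) := f :* f :+ (f :+ (con 1 :+ f))) ≡.refl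

  +-exchange : ∀ a b c → a ℕ.+ (b ℕ.+ c) ≡ b ℕ.+ (a ℕ.+ c)
  +-exchange = solve 3 (λ a b c → a :+ (b :+ c) := b :+ (a :+ c)) ≡.refl

  [a+f]+c≡f+[a+c] : ∀ a f c → (a ℕ.+ f) ℕ.+ c ≡ f ℕ.+ (a ℕ.+ c)
  [a+f]+c≡f+[a+c] = solve 3 (λ a f c → (a :+ f) :+ c := f :+ (a :+ c)) ≡.refl

  [v+u]+[f+c]≡f+[v+[u+c]] : ∀ v u f c → (v ℕ.+ u) ℕ.+ (f ℕ.+ c) ≡ f ℕ.+ (v ℕ.+ (u ℕ.+ c))
  [v+u]+[f+c]≡f+[v+[u+c]] = solve 4 (λ v u f c → (v :+ u) :+ (f :+ c) := f :+ (v :+ (u :+ c))) ≡.refl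

  [v+u]+[f+c]≡v+[f+[u+c]] : ∀ v u f c → (v ℕ.+ u) ℕ.+ (f ℕ.+ c) ≡ v ℕ.+ (f ℕ.+ (u ℕ.+ c))
  [v+u]+[f+c]≡v+[f+[u+c]] = solve 4 (λ v u f c → (v :+ u) :+ (f :+ c) := v :+ (f :+ (u :+ c))) ≡.refl

[a+f]+c∸f≡a+c : ∀ a f c → (a ℕ.+ f) ℕ.+ c ∸ f ≡ a ℕ.+ c
[a+f]+c∸f≡a+c a f c = ≡.trans (≡.cong (_∸ f) ([a+f]+c≡f+[a+c] a f c)) (ℕ.m+n∸m≡n f (a ℕ.+ c))

[v+u]+[f+c]∸f≡v+[u+c] : ∀ v u f c → (v ℕ.+ u) ℕ.+ (f ℕ.+ c) ∸ f ≡ v ℕ.+ (u ℕ.+ c)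
[v+u]+[f+c]∸f≡v+[u+c] v u f c = ≡.trans (≡.cong (_∸ f) ([v+u]+[f+c]≡f+[v+[u+c]] v u f c)) (ℕ.m+n∸m≡n f _)

[v+u]+[f+c]∸v∸f≡u+c : ∀ v u f c → (v ℕ.+ u) ℕ.+ (f ℕ.+ c) ∸ v ∸ f ≡ u ℕ.+ c
[v+u]+[f+c]∸v∸f≡u+c v u f c = ≡.trans (≡.cong (λ t → t ∸ v ∸ f) ([v+u]+[f+c]≡v+[f+[u+c]] v u f c))
  (≡.trans (≡.cong (_∸ f) (ℕ.m+n∸m≡n v _)) (ℕ.m+n∸m≡n f _))

cong₃ : ∀ {a b c d} {A : Set a} {B : Set b} {C : Set c} {D : Set d} (g : A → B → C → D)
        {x x′ y y′ z z′} → x ≡ x′ → y ≡ y′ → z ≡ z′ → g x y z ≡ g x′ y′ z′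
cong₃ g ≡.refl ≡.refl ≡.refl = ≡.refl

+m-+n≡+[m∸n] : ∀ m n → n ℕ.≤ m → + m ℤ.- + n ≡ + (m ∸ n)
+m-+n≡+[m∸n] m n n≤m = ≡.trans (ℤ.m-n≡m⊖n m n) (ℤ.⊖-≥ n≤m)

+m-+n≡-[1+k] : ∀ m n → m ℕ.< n → Σ ℕ (λ k → + m ℤ.- + n ≡ -[1+ k ])
+m-+n≡-[1+k] m n m<n with n ∸ m in n∸m≡
... | ℕ.zero = ⊥-elim (ℕ.m>n⇒m∸n≢0 m<n n∸m≡)
... | suc k  = k , ≡.trans (ℤ.m-n≡m⊖n m n) (≡.trans (ℤ.⊖-< m<n) (≡.cong (λ t → ℤ.- (+ t)) n∸m≡))

Decreasing : ∀ {s} → (Fin s → ℕ) → Set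
Decreasing {ℕ.zero} m = ⊤
Decreasing {suc s}  m = (at (λ i → m (suc i)) 0 ℕ.≤ m zero) ∧ Decreasing (λ i → m (suc i))

decreasing? : ∀ {s} (m : Fin s → ℕ) → Decreasing m ⊎ Σ (Fin s) (λ i → m i ℕ.< at m (suc (toℕ i)))
decreasing? {ℕ.zero} m = inj₁ tt
decreasing? {suc s}  m with at (λ i → m (suc i)) 0 ℕ.≤? m zero
... | no m₁≱m₂ = inj₂ (zero , ℕ.≰⇒> m₁≱m₂)
... | yes m₂≤m₁ with decreasing? (λ i → m (suc i))
...   | inj₁ dec         = inj₁ (m₂≤m₁ , dec)
...   | inj₂ (i , ascent) = inj₂ (suc i , ascent)

decreasing-next≤head : ∀ {s} (m : Fin s → ℕ) → Decreasing m → ∀ (i : Fin s) → at m (suc (toℕ i)) ℕ.≤ at m 0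
decreasing-next≤head {suc s} m (m₂≤m₁ , dec) zero    = m₂≤m₁
decreasing-next≤head {suc s} m (m₂≤m₁ , dec) (suc i) = ℕ.≤-trans (decreasing-next≤head (λ j → m (suc j)) dec i) m₂≤m₁

decreasing-at2≤at1 : ∀ {s} (m : Fin (suc s) → ℕ) → Decreasing m → at m 2 ℕ.≤ at m 1
decreasing-at2≤at1 {ℕ.zero} m dec = ℕ.z≤n
decreasing-at2≤at1 {suc s}  m dec = proj₁ (proj₂ dec)

at-cong : ∀ {s} {m m′ : Fin s → ℕ} → (∀ i → m i ≡ m′ i) → ∀ k → at m k ≡ at m′ k
at-cong {ℕ.zero} m≗m′ k       = ≡.refl
at-cong {suc s}  m≗m′ ℕ.zero  = m≗m′ zero
at-cong {suc s}  m≗m′ (suc k) = at-cong (λ i → m≗m′ (suc i)) k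

module _ where
  open ℤ-Solver.+-*-Solver

  x-v-[a+f]+w≡x-f-v-a+w : ∀ x v a f w → x ℤ.- v ℤ.- (a ℤ.+ f) ℤ.+ w ≡ (x ℤ.- f) ℤ.- v ℤ.- a ℤ.+ w
  x-v-[a+f]+w≡x-f-v-a+w = solve 5 (λ x v a f w → x :- v :- (a :+ f) :+ w := (x :- f) :- v :- a :+ w) ≡.refl

  [a+f]²-[a+f]a≡f²+fa : ∀ a f → (a ℤ.+ f) ℤ.* (a ℤ.+ f) ℤ.- (a ℤ.+ f) ℤ.* a ≡ f ℤ.* f ℤ.+ f ℤ.* a
  [a+f]²-[a+f]a≡f²+fa = solve 2 (λ a f → (a :+ f) :* (a :+ f) :- (a :+ f) :* a := f :* f :+ f :* a) ≡.refl

  x-v-[a+f]+a≡x-v-f : ∀ x v a f → x ℤ.- v ℤ.- (a ℤ.+ f) ℤ.+ a ≡ x ℤ.- v ℤ.- f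
  x-v-[a+f]+a≡x-v-f = solve 4 (λ x v a f → x :- v :- (a :+ f) :+ a := x :- v :- f) ≡.refl

  x-v-a+a≡x-v : ∀ x v a → x ℤ.- v ℤ.- a ℤ.+ a ≡ x ℤ.- v
  x-v-a+a≡x-v = solve 3 (λ x v a → x :- v :- a :+ a := x :- v) ≡.refl

  x-v-f≡x-f-v : ∀ x v f → x ℤ.- v ℤ.- f ≡ (x ℤ.- f) ℤ.- v
  x-v-f≡x-f-v = solve 3 (λ x v f → x :- v :- f := (x :- f) :- v) ≡.refl

h-v-[a+f]+w≡[h∸f]-v-a+w : ∀ h v a f w → f ℕ.≤ h →
  + h ℤ.- + v ℤ.- + (a ℕ.+ f) ℤ.+ + w ≡ + (h ∸ f) ℤ.- + v ℤ.- + a ℤ.+ + w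
h-v-[a+f]+w≡[h∸f]-v-a+w h v a f w f≤h = begin
  + h ℤ.- + v ℤ.- + (a ℕ.+ f) ℤ.+ + w     ≡⟨ ≡.cong (λ t → + h ℤ.- + v ℤ.- t ℤ.+ + w) (ℤ.pos-+ a f) ⟩
  + h ℤ.- + v ℤ.- (+ a ℤ.+ + f) ℤ.+ + w   ≡⟨ x-v-[a+f]+w≡x-f-v-a+w (+ h) (+ v) (+ a) (+ f) (+ w) ⟩
  (+ h ℤ.- + f) ℤ.- + v ℤ.- + a ℤ.+ + w   ≡⟨ ≡.cong (λ t → t ℤ.- + v ℤ.- + a ℤ.+ + w) (+m-+n≡+[m∸n] h f f≤h) ⟩
  + (h ∸ f) ℤ.- + v ℤ.- + a ℤ.+ + w       ∎
  where open ≡.≡-Reasoning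

[a+f]-a≡f : ∀ a f → + (a ℕ.+ f) ℤ.- + a ≡ + f
[a+f]-a≡f a f = ≡.trans (+m-+n≡+[m∸n] (a ℕ.+ f) a (ℕ.m≤m+n a f)) (≡.cong +_ (ℕ.m+n∸m≡n a f))

[a+f]²-[a+f]a≡+[f²+fa] : ∀ a f → + (a ℕ.+ f) ℤ.* + (a ℕ.+ f) ℤ.- + (a ℕ.+ f) ℤ.* + a ≡ + (f ℕ.* f ℕ.+ f ℕ.* a)
[a+f]²-[a+f]a≡+[f²+fa] a f = begin
  + (a ℕ.+ f) ℤ.* + (a ℕ.+ f) ℤ.- + (a ℕ.+ f) ℤ.* + a  ≡⟨ ≡.cong (λ t → t ℤ.* t ℤ.- t ℤ.* + a) (ℤ.pos-+ a f) ⟩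
  (+ a ℤ.+ + f) ℤ.* (+ a ℤ.+ + f) ℤ.- (+ a ℤ.+ + f) ℤ.* + a ≡⟨ [a+f]²-[a+f]a≡f²+fa (+ a) (+ f) ⟩
  + f ℤ.* + f ℤ.+ + f ℤ.* + a                          ≡⟨ ≡.cong₂ ℤ._+_ (ℤ.pos-* f f) (ℤ.pos-* f a) ⟨
  + (f ℕ.* f) ℤ.+ + (f ℕ.* a)                          ≡⟨ ℤ.pos-+ (f ℕ.* f) (f ℕ.* a) ⟨
  + (f ℕ.* f ℕ.+ f ℕ.* a)                              ∎
  where open ≡.≡-Reasoning

h-v-f≡[h∸f]-v : ∀ h v f → f ℕ.≤ h → + h ℤ.- + v ℤ.- + f ≡ + (h ∸ f) ℤ.- + v
h-v-f≡[h∸f]-v h v f f≤h = ≡.trans (x-v-f≡x-f-v (+ h) (+ v) (+ f)) (≡.cong (ℤ._- + v) (+m-+n≡+[m∸n] h f f≤h))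

h∸n₃∸f<n₂∸n₃ : ∀ h n₂ n₃ f → n₃ ℕ.≤ n₂ → n₂ ℕ.≤ h → h ∸ n₂ ℕ.< f → f ℕ.≤ h ∸ n₃ → h ∸ n₃ ∸ f ℕ.< n₂ ∸ n₃
h∸n₃∸f<n₂∸n₃ h n₂ n₃ f n₃≤n₂ n₂≤h h∸n₂<f f≤h∸n₃ = ℕ.≰⇒> (λ n₂∸n₃≤ → ℕ.<⇒≱ h∸n₂<f (f≤h∸n₂ n₂∸n₃≤))
  where
  f≤h∸n₂ : n₂ ∸ n₃ ℕ.≤ h ∸ n₃ ∸ f → f ℕ.≤ h ∸ n₂
  f≤h∸n₂ n₂∸n₃≤ = ≡.subst (λ t → f ℕ.≤ t ∸ n₂) (ℕ.m+[n∸m]≡n (ℕ.≤-trans n₃≤n₂ n₂≤h))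
                   (≡.subst (ℕ._≤ (n₃ ℕ.+ (h ∸ n₃)) ∸ n₂) (ℕ.m+n∸m≡n n₂ f) (ℕ.∸-monoˡ-≤ n₂ n₂+f≤))
    where
    n₂+f≤ : n₂ ℕ.+ f ℕ.≤ n₃ ℕ.+ (h ∸ n₃)
    n₂+f≤ = ≡.subst (ℕ._≤ n₃ ℕ.+ (h ∸ n₃)) (≡.trans (≡.sym (ℕ.+-assoc n₃ (n₂ ∸ n₃) f)) (≡.cong (ℕ._+ f) (ℕ.m+[n∸m]≡n n₃≤n₂)))
              (ℕ.+-monoʳ-≤ n₃ (≡.subst (n₂ ∸ n₃ ℕ.+ f ℕ.≤_) (ℕ.m∸n+n≡m f≤h∸n₃) (ℕ.+-monoˡ-≤ f n₂∸n₃≤)))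

-- Every commutative ring is a ℤ-algebra; this gives the ring solver integer
-- coefficients, so that identities such as 1 - x + x = 1 can be normalised.
module IntegerCoefficients {c ℓ} (R : CommutativeRing c ℓ) where
  open CommutativeRing R
  open import Relation.Binary.Reasoning.Setoid setoid
  open RingProperties ring using (-‿distribˡ-*; -‿distribʳ-*; -0#≈0#; -‿involutive; -‿+-comm)
  open SemiringMultiplication semiring using (_×_; ×-homo-+; ×1-homo-*)

  fromℤ : ℤ → Carrier
  fromℤ (+ n)     = n × 1#
  fromℤ -[1+ n ]  = - (suc n × 1#)

  fromℤ-neg+ : ∀ k → fromℤ (ℤ.- (+ k)) ≈ - (k × 1#)
  fromℤ-neg+ ℕ.zero  = sym -0#≈0#
  fromℤ-neg+ (suc k) = refl

  fromℤ-◃ : ∀ k → fromℤ (Sign.+ ◃ k) ≈ k × 1#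
  fromℤ-◃ ℕ.zero  = refl
  fromℤ-◃ (suc k) = refl

  fromℤ-◃- : ∀ k → fromℤ (Sign.- ◃ k) ≈ - (k × 1#)
  fromℤ-◃- ℕ.zero  = sym -0#≈0#
  fromℤ-◃- (suc k) = refl

  x+y-x≈y : ∀ x y → x + (y - x) ≈ y
  x+y-x≈y x y = begin
    x + (y - x)    ≈⟨ +-congˡ (+-comm y (- x)) ⟩
    x + (- x + y)  ≈⟨ +-assoc x (- x) y ⟨
    (x - x) + y    ≈⟨ +-congʳ (-‿inverseʳ x) ⟩
    0# + y         ≈⟨ +-identityˡ y ⟩
    y              ∎

  fromℤ-⊖ : ∀ m n → fromℤ (m ⊖ n) ≈ m × 1# - n × 1#
  fromℤ-⊖ m n with m ℕ.≤? n
  ... | yes m≤n = begin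
    fromℤ (m ⊖ n)              ≡⟨ ≡.cong fromℤ (ℤ.⊖-≤ m≤n) ⟩
    fromℤ (ℤ.- (+ (n ∸ m)))    ≈⟨ fromℤ-neg+ (n ∸ m) ⟩
    - ((n ∸ m) × 1#)           ≈⟨ x+y-x≈y (m × 1#) _ ⟨
    m × 1# + (- ((n ∸ m) × 1#) - m × 1#)  ≈⟨ +-congˡ (-‿+-comm _ _) ⟩
    m × 1# - ((n ∸ m) × 1# + m × 1#)      ≈⟨ +-congˡ (-‿cong (×-homo-+ 1# (n ∸ m) m)) ⟨
    m × 1# - ((n ∸ m ℕ.+ m) × 1#)         ≡⟨ ≡.cong (λ t → m × 1# - t × 1#) (ℕ.m∸n+n≡m m≤n) ⟩
    m × 1# - n × 1#            ∎
  ... | no m≰n = begin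
    fromℤ (m ⊖ n)              ≡⟨ ≡.cong fromℤ (ℤ.⊖-≥ n≤m) ⟩
    (m ∸ n) × 1#               ≈⟨ x+y-x≈y (n × 1#) _ ⟨
    n × 1# + ((m ∸ n) × 1# - n × 1#)  ≈⟨ +-assoc _ _ _ ⟨
    (n × 1# + (m ∸ n) × 1#) - n × 1#  ≈⟨ +-congʳ (×-homo-+ 1# n (m ∸ n)) ⟨
    (n ℕ.+ (m ∸ n)) × 1# - n × 1#     ≡⟨ ≡.cong (λ t → t × 1# - n × 1#) (ℕ.m+[n∸m]≡n n≤m) ⟩
    m × 1# - n × 1#            ∎
    where n≤m = ℕ.≰⇒≥ m≰n

  fromℤ-+ : ∀ x y → fromℤ (x ℤ.+ y) ≈ fromℤ x + fromℤ y
  fromℤ-+ (+ m)    (+ n)    = ×-homo-+ 1# m n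
  fromℤ-+ (+ m)    -[1+ n ] = fromℤ-⊖ m (suc n)
  fromℤ-+ -[1+ m ] (+ n)    = trans (fromℤ-⊖ n (suc m)) (+-comm _ _)
  fromℤ-+ -[1+ m ] -[1+ n ] = begin
    - (suc (suc (m ℕ.+ n)) × 1#)    ≡⟨ ≡.cong (λ t → - (suc t × 1#)) (ℕ.+-suc m n) ⟨
    - ((suc m ℕ.+ suc n) × 1#)      ≈⟨ -‿cong (×-homo-+ 1# (suc m) (suc n)) ⟩
    - (suc m × 1# + suc n × 1#)     ≈⟨ -‿+-comm _ _ ⟨
    - (suc m × 1#) + - (suc n × 1#) ∎

  -x*-y≈x*y : ∀ x y → - x * - y ≈ x * y
  -x*-y≈x*y x y = begin
    - x * - y    ≈⟨ -‿distribˡ-* x (- y) ⟨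
    - (x * - y)  ≈⟨ -‿cong (-‿distribʳ-* x y) ⟨
    - - (x * y)  ≈⟨ -‿involutive _ ⟩
    x * y        ∎

  fromℤ-* : ∀ x y → fromℤ (x ℤ.* y) ≈ fromℤ x * fromℤ y
  fromℤ-* (+ m)    (+ n)    = trans (fromℤ-◃ (m ℕ.* n)) (×1-homo-* m n)
  fromℤ-* (+ m)    -[1+ n ] = trans (fromℤ-◃- (m ℕ.* suc n)) (trans (-‿cong (×1-homo-* m (suc n))) (-‿distribʳ-* _ _))
  fromℤ-* -[1+ m ] (+ n)    = trans (fromℤ-◃- (suc m ℕ.* n)) (trans (-‿cong (×1-homo-* (suc m) n)) (-‿distribˡ-* _ _))
  fromℤ-* -[1+ m ] -[1+ n ] = trans (fromℤ-◃ (suc m ℕ.* suc n)) (trans (×1-homo-* (suc m) (suc n)) (sym (-x*-y≈x*y _ _)))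

  fromℤ-neg : ∀ x → fromℤ (ℤ.- x) ≈ - fromℤ x
  fromℤ-neg (+ ℕ.zero) = sym -0#≈0#
  fromℤ-neg (+ suc n)  = refl
  fromℤ-neg -[1+ n ]   = sym (-‿involutive _)

  fromℤ-homomorphism : CommutativeRing.rawRing ℤ.+-*-commutativeRing ACR.-Raw-AlmostCommutative⟶ ACR.fromCommutativeRing R
  fromℤ-homomorphism = record
    { ⟦_⟧    = fromℤ
    ; +-homo = fromℤ-+
    ; *-homo = fromℤ-*
    ; -‿homo = fromℤ-neg
    ; 0-homo = refl
    ; 1-homo = refl
    }

  fromℤ-≟ : ∀ x y → Maybe (fromℤ x ≈ fromℤ y)
  fromℤ-≟ x y with x ℤ.≟ y
  ... | yes ≡.refl = just refl
  ... | no _       = nothing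

  open RingSolver (CommutativeRing.rawRing ℤ.+-*-commutativeRing) (ACR.fromCommutativeRing R) fromℤ-homomorphism fromℤ-≟ public
    using (solve; _:=_; _:+_; _:*_; _:-_; con)

module FieldLemmas {c ℓ} (F : Field c ℓ) where
  open Field F public hiding (zero)
  open FieldOps F public using (pow; zpow; poch; pochℤ; qbinℕ; qbin; prodFin; sumTo; boxSum; nxt; Φ; K)
  open import Relation.Binary.Reasoning.Setoid setoid public
  open IntegerCoefficients commRing public using (solve; _:=_; _:+_; _:*_; _:-_; con)
  open AbelianGroupProperties +-abelianGroup using (x∙y⁻¹≈ε⇒x≈y)

  1≉0 : ¬ (1# ≈ 0#)
  1≉0 1≈0 = 0≉1 (sym 1≈0)

  inv-l : ∀ x → ¬ (x ≈ 0#) → inv x * x ≈ 1#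
  inv-l x x≉0 = trans (*-comm _ _) (inv-r x x≉0)

  *-cancelʳ : ∀ {x y d} → ¬ (d ≈ 0#) → x * d ≈ y * d → x ≈ y
  *-cancelʳ {x} {y} {d} d≉0 xd≈yd = begin
    x                ≈⟨ *-identityʳ x ⟨
    x * 1#           ≈⟨ *-congˡ (inv-r d d≉0) ⟨
    x * (d * inv d)  ≈⟨ *-assoc _ _ _ ⟨
    (x * d) * inv d  ≈⟨ *-congʳ xd≈yd ⟩
    (y * d) * inv d  ≈⟨ *-assoc _ _ _ ⟩
    y * (d * inv d)  ≈⟨ *-congˡ (inv-r d d≉0) ⟩
    y * 1#           ≈⟨ *-identityʳ y ⟩
    y                ∎

  *-≉0 : ∀ {a b} → ¬ (a ≈ 0#) → ¬ (b ≈ 0#) → ¬ (a * b ≈ 0#)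
  *-≉0 {a} {b} a≉0 b≉0 ab≈0 = a≉0 (*-cancelʳ b≉0 (trans ab≈0 (sym (zeroˡ b))))

  inv-* : ∀ a b → ¬ (a ≈ 0#) → ¬ (b ≈ 0#) → inv (a * b) ≈ inv a * inv b
  inv-* a b a≉0 b≉0 = *-cancelʳ (*-≉0 a≉0 b≉0) (begin
    inv (a * b) * (a * b)      ≈⟨ inv-l _ (*-≉0 a≉0 b≉0) ⟩
    1#                         ≈⟨ *-identityʳ 1# ⟨
    1# * 1#                    ≈⟨ *-cong (inv-l a a≉0) (inv-l b b≉0) ⟨
    (inv a * a) * (inv b * b)  ≈⟨ solve 4 (λ x y u v → (x :* y) :* (u :* v) := (x :* u) :* (y :* v)) refl _ _ _ _ ⟩
    (inv a * inv b) * (a * b)  ∎)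

  *-≈0ˡ : ∀ {x} y → x ≈ 0# → x * y ≈ 0#
  *-≈0ˡ y x≈0 = trans (*-congʳ x≈0) (zeroˡ y)

  *-≈0ʳ : ∀ x {y} → y ≈ 0# → x * y ≈ 0#
  *-≈0ʳ x y≈0 = trans (*-congˡ y≈0) (zeroʳ x)

  inv-1 : inv 1# ≈ 1#
  inv-1 = trans (sym (*-identityˡ _)) (inv-r 1# 1≉0)

  1-x≉0 : ∀ x → ¬ (x ≈ 1#) → ¬ (1# - x ≈ 0#)
  1-x≉0 x x≉1 1-x≈0 = x≉1 (sym (x∙y⁻¹≈ε⇒x≈y 1# x 1-x≈0))

  sumTo-cong : ∀ N {f g : ℕ → Carrier} → (∀ j → f j ≈ g j) → sumTo N f ≈ sumTo N g
  sumTo-cong ℕ.zero  f≈g = f≈g 0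
  sumTo-cong (suc N) f≈g = +-cong (sumTo-cong N f≈g) (f≈g (suc N))

  sumTo-+ : ∀ N (f g : ℕ → Carrier) → sumTo N (λ j → f j + g j) ≈ sumTo N f + sumTo N g
  sumTo-+ ℕ.zero  f g = refl
  sumTo-+ (suc N) f g = trans (+-congʳ (sumTo-+ N f g))
    (solve 4 (λ a b x y → (a :+ b) :+ (x :+ y) := (a :+ x) :+ (b :+ y)) refl _ _ _ _)

  sumTo-*ˡ : ∀ N (a : Carrier) (f : ℕ → Carrier) → sumTo N (λ j → a * f j) ≈ a * sumTo N f
  sumTo-*ˡ ℕ.zero  a f = refl
  sumTo-*ˡ (suc N) a f = trans (+-congʳ (sumTo-*ˡ N a f)) (sym (distribˡ a _ _))

  sumTo-0 : ∀ N {f : ℕ → Carrier} → (∀ j → f j ≈ 0#) → sumTo N f ≈ 0#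
  sumTo-0 ℕ.zero  f≈0 = f≈0 0
  sumTo-0 (suc N) f≈0 = trans (+-cong (sumTo-0 N f≈0) (f≈0 (suc N))) (+-identityʳ 0#)

  sumTo-comm : ∀ N M (g : ℕ → ℕ → Carrier) →
    sumTo N (λ j → sumTo M (g j)) ≈ sumTo M (λ k → sumTo N (λ j → g j k))
  sumTo-comm ℕ.zero  M g = refl
  sumTo-comm (suc N) M g = trans (+-congʳ (sumTo-comm N M g)) (sym (sumTo-+ M _ _))

  sumTo-head : ∀ N (f : ℕ → Carrier) → sumTo (suc N) f ≈ f 0 + sumTo N (λ j → f (suc j))
  sumTo-head ℕ.zero  f = refl
  sumTo-head (suc N) f = trans (+-congʳ (sumTo-head N f)) (+-assoc _ _ _)

  sumTo-last0 : ∀ N {f : ℕ → Carrier} → f (suc N) ≈ 0# → sumTo (suc N) f ≈ sumTo N f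
  sumTo-last0 N f≈0 = trans (+-congˡ f≈0) (+-identityʳ _)

  sumTo-only0 : ∀ N (f : ℕ → Carrier) → (∀ j → f (suc j) ≈ 0#) → sumTo N f ≈ f 0
  sumTo-only0 ℕ.zero  f f≈0 = refl
  sumTo-only0 (suc N) f f≈0 = trans (sumTo-last0 N (f≈0 N)) (sumTo-only0 N f f≈0)

  sumTo-shift : ∀ N t (f : ℕ → Carrier) →
    (∀ j → j ℕ.< t → f j ≈ 0#) → (∀ j → N ℕ.< j → f j ≈ 0#) →
    sumTo N f ≈ sumTo N (λ j → f (t ℕ.+ j))
  sumTo-shift N ℕ.zero  f low high = refl
  sumTo-shift N (suc t) f low high = begin
    sumTo N f                           ≈⟨ sumTo-last0 N (high (suc N) ℕ.≤-refl) ⟨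
    sumTo (suc N) f                     ≈⟨ sumTo-head N f ⟩
    f 0 + sumTo N (λ j → f (suc j))     ≈⟨ +-congʳ (low 0 (ℕ.s≤s ℕ.z≤n)) ⟩
    0# + sumTo N (λ j → f (suc j))      ≈⟨ +-identityˡ _ ⟩
    sumTo N (λ j → f (suc j))           ≈⟨ sumTo-shift N t (λ j → f (suc j)) (λ j j<t → low (suc j) (ℕ.s≤s j<t))
                                                                              (λ j N<j → high (suc j) (ℕ.m≤n⇒m≤1+n N<j)) ⟩
    sumTo N (λ j → f (suc (t ℕ.+ j)))   ∎

  boxSum-cong : ∀ s N {f g : (Fin s → ℕ) → Carrier} → (∀ m → f m ≈ g m) → boxSum s N f ≈ boxSum s N g
  boxSum-cong ℕ.zero  N f≈g = f≈g _
  boxSum-cong (suc s) N f≈g = sumTo-cong N (λ j → boxSum-cong s N (λ m → f≈g _))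

  boxSum-*ˡ : ∀ s N (a : Carrier) (f : (Fin s → ℕ) → Carrier) → boxSum s N (λ m → a * f m) ≈ a * boxSum s N f
  boxSum-*ˡ ℕ.zero  N a f = refl
  boxSum-*ˡ (suc s) N a f = trans (sumTo-cong N (λ j → boxSum-*ˡ s N a _)) (sumTo-*ˡ N a _)

  boxSum-0 : ∀ s N {f : (Fin s → ℕ) → Carrier} → (∀ m → f m ≈ 0#) → boxSum s N f ≈ 0#
  boxSum-0 ℕ.zero  N f≈0 = f≈0 _
  boxSum-0 (suc s) N f≈0 = sumTo-0 N (λ j → boxSum-0 s N (λ m → f≈0 _))

  sumTo-boxSum-comm : ∀ s N M (G : ℕ → (Fin s → ℕ) → Carrier) →
    sumTo N (λ j → boxSum s M (G j)) ≈ boxSum s M (λ m → sumTo N (λ j → G j m))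
  sumTo-boxSum-comm ℕ.zero  N M G = refl
  sumTo-boxSum-comm (suc s) N M G = trans (sumTo-comm N M _) (sumTo-cong M (λ k → sumTo-boxSum-comm s N M _))

  prodFin-cong : ∀ {s} {f g : Fin s → Carrier} → (∀ i → f i ≈ g i) → prodFin f ≈ prodFin g
  prodFin-cong {ℕ.zero}  f≈g = refl
  prodFin-cong {suc s}   f≈g = *-cong (f≈g zero) (prodFin-cong (λ i → f≈g (suc i)))

  prodFin-* : ∀ {s} (f g : Fin s → Carrier) → prodFin (λ i → f i * g i) ≈ prodFin f * prodFin g
  prodFin-* {ℕ.zero} f g = sym (*-identityˡ 1#)
  prodFin-* {suc s}  f g = trans (*-congˡ (prodFin-* (λ i → f (suc i)) (λ i → g (suc i))))
    (solve 4 (λ a b c d → (a :* b) :* (c :* d) := (a :* c) :* (b :* d)) refl _ _ _ _)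

  prodFin-0 : ∀ {s} (f : Fin s → Carrier) i → f i ≈ 0# → prodFin f ≈ 0#
  prodFin-0 f zero    fi≈0 = *-≈0ˡ _ fi≈0
  prodFin-0 f (suc i) fi≈0 = *-≈0ʳ _ (prodFin-0 (λ j → f (suc j)) i fi≈0)

  pow-+ : ∀ x a b → pow x (a ℕ.+ b) ≈ pow x a * pow x b
  pow-+ x ℕ.zero  b = sym (*-identityˡ _)
  pow-+ x (suc a) b = trans (*-congʳ (pow-+ x a b)) (solve 3 (λ u v w → (u :* v) :* w := (u :* w) :* v) refl _ _ _)

  pow-* : ∀ x y a → pow (x * y) a ≈ pow x a * pow y a
  pow-* x y ℕ.zero  = sym (*-identityˡ _)
  pow-* x y (suc a) = trans (*-congʳ (pow-* x y a))
    (solve 4 (λ u v w t → (u :* v) :* (w :* t) := (u :* w) :* (v :* t)) refl _ _ _ _)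

  pow-pow : ∀ x a b → pow x (a ℕ.* b) ≈ pow (pow x a) b
  pow-pow x a ℕ.zero  = ≡.subst (λ t → pow x t ≈ 1#) (≡.sym (ℕ.*-zeroʳ a)) refl
  pow-pow x a (suc b) = begin
    pow x (a ℕ.* suc b)        ≡⟨ ≡.cong (pow x) (ℕ.*-suc a b) ⟩
    pow x (a ℕ.+ a ℕ.* b)      ≈⟨ pow-+ x a (a ℕ.* b) ⟩
    pow x a * pow x (a ℕ.* b)  ≈⟨ *-congˡ (pow-pow x a b) ⟩
    pow x a * pow (pow x a) b  ≈⟨ *-comm _ _ ⟩
    pow (pow x a) b * pow x a  ∎

  pow-square-suc : ∀ x f → pow x (suc f ℕ.* suc f) ≈ pow x (f ℕ.* f) * (pow x f * pow x (suc f))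
  pow-square-suc x f = begin
    pow x (suc f ℕ.* suc f)                  ≡⟨ ≡.cong (pow x) (square-suc f) ⟩
    pow x (f ℕ.* f ℕ.+ (f ℕ.+ suc f))        ≈⟨ pow-+ x (f ℕ.* f) _ ⟩
    pow x (f ℕ.* f) * pow x (f ℕ.+ suc f)    ≈⟨ *-congˡ (pow-+ x f (suc f)) ⟩
    pow x (f ℕ.* f) * (pow x f * pow x (suc f)) ∎

  poch-cong : ∀ q {x y} n → x ≈ y → poch q x n ≈ poch q y n
  poch-cong q ℕ.zero  x≈y = refl
  poch-cong q (suc n) x≈y = *-cong (poch-cong q n x≈y) (+-congˡ (-‿cong (*-congʳ x≈y)))

  poch-+ : ∀ q x a b → poch q x (a ℕ.+ b) ≈ poch q x a * poch q (x * pow q a) b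
  poch-+ q x a ℕ.zero  = ≡.subst (λ t → poch q x t ≈ poch q x a * 1#) (≡.sym (ℕ.+-identityʳ a)) (sym (*-identityʳ _))
  poch-+ q x a (suc b) = begin
    poch q x (a ℕ.+ suc b)                          ≡⟨ ≡.cong (poch q x) (ℕ.+-suc a b) ⟩
    poch q x (a ℕ.+ b) * (1# - x * pow q (a ℕ.+ b)) ≈⟨ *-cong (poch-+ q x a b) (+-congˡ (-‿cong x[qᵃqᵇ]≈[xqᵃ]qᵇ)) ⟩
    (poch q x a * poch q (x * pow q a) b) * (1# - (x * pow q a) * pow q b)   ≈⟨ *-assoc _ _ _ ⟩
    poch q x a * (poch q (x * pow q a) b * (1# - (x * pow q a) * pow q b))   ∎
    where
    x[qᵃqᵇ]≈[xqᵃ]qᵇ : x * pow q (a ℕ.+ b) ≈ (x * pow q a) * pow q b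
    x[qᵃqᵇ]≈[xqᵃ]qᵇ = trans (*-congˡ (pow-+ q a b)) (sym (*-assoc _ _ _))

  poch-suc-head : ∀ q x n → poch q x (suc n) ≈ (1# - x) * poch q (x * q) n
  poch-suc-head q x n = begin
    poch q x (1 ℕ.+ n)                   ≈⟨ poch-+ q x 1 n ⟩
    poch q x 1 * poch q (x * pow q 1) n  ≈⟨ *-cong (trans (*-identityˡ _) (+-congˡ (-‿cong (*-identityʳ x))))
                                                   (poch-cong q n (*-congˡ (*-identityˡ q))) ⟩
    (1# - x) * poch q (x * q) n          ∎

  poch-≉0 : ∀ q x n → (∀ k → k ℕ.< n → ¬ (x * pow q k ≈ 1#)) → ¬ (poch q x n ≈ 0#)
  poch-≉0 q x ℕ.zero  x≉q⁻ᵏ = 1≉0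
  poch-≉0 q x (suc n) x≉q⁻ᵏ =
    *-≉0 (poch-≉0 q x n (λ k k<n → x≉q⁻ᵏ k (ℕ.m≤n⇒m≤1+n k<n))) (1-x≉0 _ (x≉q⁻ᵏ n ℕ.≤-refl))

module GenericQ {c ℓ} (F : Field c ℓ) (q : Field.Carrier F)
                (q-notRootOfUnity : ∀ j → ¬ (Field._≈_ F (FieldOps.pow F q (suc j)) (Field.1# F))) where
  open FieldLemmas F

  fac : ℕ → Carrier
  fac = poch q q

  fac⁻¹ : ℕ → Carrier
  fac⁻¹ a = inv (fac a)

  fac-≉0 : ∀ a → ¬ (fac a ≈ 0#)
  fac-≉0 a = poch-≉0 q q a (λ k _ q·qᵏ≈1 → q-notRootOfUnity k (trans (*-comm _ _) q·qᵏ≈1))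

  fac*fac⁻¹ : ∀ a → fac a * fac⁻¹ a ≈ 1#
  fac*fac⁻¹ a = inv-r _ (fac-≉0 a)

  fac⁻¹-0 : fac⁻¹ 0 ≈ 1#
  fac⁻¹-0 = inv-1

  fac⁻¹-suc : ∀ a → fac⁻¹ a ≈ (1# - q * pow q a) * fac⁻¹ (suc a)
  fac⁻¹-suc a = sym (begin
    t * inv (fac a * t)        ≈⟨ *-congˡ (inv-* _ _ (fac-≉0 a) t≉0) ⟩
    t * (fac⁻¹ a * inv t)      ≈⟨ solve 3 (λ x y z → x :* (y :* z) := y :* (x :* z)) refl _ _ _ ⟩
    fac⁻¹ a * (t * inv t)      ≈⟨ *-congˡ (inv-r t t≉0) ⟩
    fac⁻¹ a * 1#               ≈⟨ *-identityʳ _ ⟩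
    fac⁻¹ a                    ∎)
    where
    t = 1# - q * pow q a
    t≉0 = 1-x≉0 _ (λ q·qᵃ≈1 → q-notRootOfUnity a (trans (*-comm _ _) q·qᵃ≈1))

  qbinℕ-fac : ∀ {a} b c → b ℕ.+ c ≡ a → qbinℕ q a b ≈ fac a * (fac⁻¹ b * fac⁻¹ c)
  qbinℕ-fac {a} b c b+c≡a with b ℕ.≤? a
  ... | yes b≤a = *-congˡ (trans (inv-* _ _ (fac-≉0 b) (fac-≉0 (a ∸ b)))
                                 (*-congˡ (reflexive (≡.cong fac⁻¹ a∸b≡c))))
    where a∸b≡c = ≡.trans (≡.cong (_∸ b) (≡.sym b+c≡a)) (ℕ.m+n∸m≡n b c)
  ... | no b≰a  = ⊥-elim (b≰a (≡.subst (b ℕ.≤_) b+c≡a (ℕ.m≤m+n b c)))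

  qbinℕ-> : ∀ a b → a ℕ.< b → qbinℕ q a b ≈ 0#
  qbinℕ-> a b a<b with b ℕ.≤? a
  ... | yes b≤a = ⊥-elim (ℕ.<⇒≱ a<b b≤a)
  ... | no _    = refl

  qbinℕ-0 : ∀ d → qbinℕ q d 0 ≈ 1#
  qbinℕ-0 d = trans (qbinℕ-fac 0 d ≡.refl)
    (trans (*-congˡ (trans (*-congʳ fac⁻¹-0) (*-identityˡ _))) (fac*fac⁻¹ d))

  qbinℕ-diag : ∀ d → qbinℕ q d d ≈ 1#
  qbinℕ-diag d = trans (qbinℕ-fac d 0 (ℕ.+-identityʳ d))
    (trans (*-congˡ (trans (*-congˡ fac⁻¹-0) (*-identityʳ _))) (fac*fac⁻¹ d))

  trinomial : ℕ → ℕ → ℕ → Carrier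
  trinomial a b c = fac (a ℕ.+ (b ℕ.+ c)) * (fac⁻¹ a * (fac⁻¹ b * fac⁻¹ c))

  qbinℕ-qbinℕ≈trinomial : ∀ a b c →
    qbinℕ q (a ℕ.+ (b ℕ.+ c)) a * qbinℕ q (b ℕ.+ c) b ≈ trinomial a b c
  qbinℕ-qbinℕ≈trinomial a b c = begin
    qbinℕ q H a * qbinℕ q (b ℕ.+ c) b
      ≈⟨ *-cong (qbinℕ-fac a (b ℕ.+ c) ≡.refl) (qbinℕ-fac b c ≡.refl) ⟩
    (fac H * (fac⁻¹ a * fac⁻¹ (b ℕ.+ c))) * (fac (b ℕ.+ c) * (fac⁻¹ b * fac⁻¹ c))
      ≈⟨ solve 6 (λ x y z u v w → (x :* (y :* z)) :* (u :* (v :* w)) := (u :* z) :* (x :* (y :* (v :* w)))) refl _ _ _ _ _ _ ⟩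
    (fac (b ℕ.+ c) * fac⁻¹ (b ℕ.+ c)) * trinomial a b c
      ≈⟨ *-congʳ (fac*fac⁻¹ (b ℕ.+ c)) ⟩
    1# * trinomial a b c
      ≈⟨ *-identityˡ _ ⟩
    trinomial a b c ∎
    where H = a ℕ.+ (b ℕ.+ c)

  trinomial-swap : ∀ a b c → trinomial a b c ≈ trinomial b a c
  trinomial-swap a b c = trans (reflexive (≡.cong (λ t → fac t * (fac⁻¹ a * (fac⁻¹ b * fac⁻¹ c))) (+-exchange a b c)))
    (*-congˡ (solve 3 (λ x y z → x :* (y :* z) := y :* (x :* z)) refl _ _ _))

  qbinℕ-qbinℕ-swap : ∀ a b c →
    qbinℕ q (a ℕ.+ (b ℕ.+ c)) a * qbinℕ q (b ℕ.+ c) b ≈ qbinℕ q (b ℕ.+ (a ℕ.+ c)) b * qbinℕ q (a ℕ.+ c) a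
  qbinℕ-qbinℕ-swap a b c = trans (qbinℕ-qbinℕ≈trinomial a b c)
    (trans (trinomial-swap a b c) (sym (qbinℕ-qbinℕ≈trinomial b a c)))

  qbinℕ-qbinℕ-regroup : ∀ a b c →
    qbinℕ q ((a ℕ.+ b) ℕ.+ c) (a ℕ.+ b) * qbinℕ q (a ℕ.+ b) a ≈ qbinℕ q (a ℕ.+ (b ℕ.+ c)) a * qbinℕ q (b ℕ.+ c) b
  qbinℕ-qbinℕ-regroup a b c = begin
    qbinℕ q H (a ℕ.+ b) * qbinℕ q (a ℕ.+ b) a
      ≈⟨ *-cong (qbinℕ-fac (a ℕ.+ b) c ≡.refl) (qbinℕ-fac a b ≡.refl) ⟩
    (fac H * (fac⁻¹ (a ℕ.+ b) * fac⁻¹ c)) * (fac (a ℕ.+ b) * (fac⁻¹ a * fac⁻¹ b))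
      ≈⟨ solve 6 (λ x y z u v w → (x :* (y :* z)) :* (u :* (v :* w)) := (u :* y) :* (x :* (v :* (w :* z)))) refl _ _ _ _ _ _ ⟩
    (fac (a ℕ.+ b) * fac⁻¹ (a ℕ.+ b)) * (fac H * (fac⁻¹ a * (fac⁻¹ b * fac⁻¹ c)))
      ≈⟨ trans (*-congʳ (fac*fac⁻¹ (a ℕ.+ b))) (*-identityˡ _) ⟩
    fac H * (fac⁻¹ a * (fac⁻¹ b * fac⁻¹ c))
      ≡⟨ ≡.cong (λ t → fac t * (fac⁻¹ a * (fac⁻¹ b * fac⁻¹ c))) (ℕ.+-assoc a b c) ⟩
    trinomial a b c
      ≈⟨ qbinℕ-qbinℕ≈trinomial a b c ⟨
    qbinℕ q (a ℕ.+ (b ℕ.+ c)) a * qbinℕ q (b ℕ.+ c) b ∎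
    where H = (a ℕ.+ b) ℕ.+ c

  qbinℕ-nested : ∀ h f a → f ℕ.≤ h → qbinℕ q h (a ℕ.+ f) * qbinℕ q (a ℕ.+ f) a ≈ qbinℕ q h f * qbinℕ q (h ∸ f) a
  qbinℕ-nested h f a f≤h with ℕ.≤-<-connex (a ℕ.+ f) h
  ... | inj₁ a+f≤h = ≡.subst (λ t → qbinℕ q t (a ℕ.+ f) * qbinℕ q (a ℕ.+ f) a ≈ qbinℕ q t f * qbinℕ q (t ∸ f) a)
                             (ℕ.m+[n∸m]≡n a+f≤h) (canonical (h ∸ (a ℕ.+ f)))
    where
    canonical : ∀ c → qbinℕ q ((a ℕ.+ f) ℕ.+ c) (a ℕ.+ f) * qbinℕ q (a ℕ.+ f) a
                    ≈ qbinℕ q ((a ℕ.+ f) ℕ.+ c) f * qbinℕ q (((a ℕ.+ f) ℕ.+ c) ∸ f) a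
    canonical c = begin
      qbinℕ q ((a ℕ.+ f) ℕ.+ c) (a ℕ.+ f) * qbinℕ q (a ℕ.+ f) a ≈⟨ qbinℕ-qbinℕ-regroup a f c ⟩
      qbinℕ q (a ℕ.+ (f ℕ.+ c)) a * qbinℕ q (f ℕ.+ c) f         ≈⟨ qbinℕ-qbinℕ-swap a f c ⟩
      qbinℕ q (f ℕ.+ (a ℕ.+ c)) f * qbinℕ q (a ℕ.+ c) a
        ≡⟨ ≡.cong₂ (λ u v → qbinℕ q u f * qbinℕ q v a) (≡.sym ([a+f]+c≡f+[a+c] a f c)) (≡.sym ([a+f]+c∸f≡a+c a f c)) ⟩
      qbinℕ q ((a ℕ.+ f) ℕ.+ c) f * qbinℕ q (((a ℕ.+ f) ℕ.+ c) ∸ f) a ∎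
  ... | inj₂ h<a+f = trans (trans (*-congʳ (qbinℕ-> h (a ℕ.+ f) h<a+f)) (zeroˡ _))
                          (sym (trans (*-congˡ (qbinℕ-> (h ∸ f) a h∸f<a)) (zeroʳ _)))
    where h∸f<a = ℕ.≰⇒> (λ a≤h∸f → ℕ.<⇒≱ h<a+f (≡.subst (a ℕ.+ f ℕ.≤_) (ℕ.m∸n+n≡m f≤h) (ℕ.+-monoˡ-≤ f a≤h∸f)))

  qbinℕ-triple : ∀ h n₁ n₂ f → n₂ ℕ.≤ n₁ → f ℕ.≤ h ∸ n₁ → n₁ ℕ.≤ h →
    qbinℕ q h f * qbinℕ q (h ∸ n₂ ∸ f) (n₁ ∸ n₂) * qbinℕ q (h ∸ f) n₂ ≈ qbinℕ q h n₁ * qbinℕ q n₁ n₂ * qbinℕ q (h ∸ n₁) f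
  qbinℕ-triple h n₁ n₂ f n₂≤n₁ f≤h∸n₁ n₁≤h =
    ≡.subst₂ (λ H N₁ → qbinℕ q H f * qbinℕ q (H ∸ n₂ ∸ f) (N₁ ∸ n₂) * qbinℕ q (H ∸ f) n₂
                     ≈ qbinℕ q H N₁ * qbinℕ q N₁ n₂ * qbinℕ q (H ∸ N₁) f)
             h≡ n₁≡ (canonical n₂ (n₁ ∸ n₂) (h ∸ n₁ ∸ f))
    where
    n₁≡ = ℕ.m+[n∸m]≡n n₂≤n₁
    h≡ = ≡.trans (≡.cong₂ ℕ._+_ n₁≡ (ℕ.m+[n∸m]≡n f≤h∸n₁)) (ℕ.m+[n∸m]≡n n₁≤h)
    canonical : ∀ v u c → let H = (v ℕ.+ u) ℕ.+ (f ℕ.+ c) in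
      qbinℕ q H f * qbinℕ q (H ∸ v ∸ f) ((v ℕ.+ u) ∸ v) * qbinℕ q (H ∸ f) v
        ≈ qbinℕ q H (v ℕ.+ u) * qbinℕ q (v ℕ.+ u) v * qbinℕ q (H ∸ (v ℕ.+ u)) f
    canonical v u c = begin
      qbinℕ q H f * qbinℕ q (H ∸ v ∸ f) ((v ℕ.+ u) ∸ v) * qbinℕ q (H ∸ f) v
        ≡⟨ cong₃ (λ x y z → qbinℕ q H f * qbinℕ q x y * qbinℕ q z v)
                   ([v+u]+[f+c]∸v∸f≡u+c v u f c) (ℕ.m+n∸m≡n v u) ([v+u]+[f+c]∸f≡v+[u+c] v u f c) ⟩
      qbinℕ q H f * qbinℕ q (u ℕ.+ c) u * qbinℕ q (v ℕ.+ (u ℕ.+ c)) v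
        ≈⟨ solve 3 (λ a b c → a :* b :* c := (a :* c) :* b) refl _ _ _ ⟩
      (qbinℕ q H f * qbinℕ q (v ℕ.+ (u ℕ.+ c)) v) * qbinℕ q (u ℕ.+ c) u
        ≡⟨ ≡.cong (λ t → (qbinℕ q t f * qbinℕ q (v ℕ.+ (u ℕ.+ c)) v) * qbinℕ q (u ℕ.+ c) u) ([v+u]+[f+c]≡f+[v+[u+c]] v u f c) ⟩
      (qbinℕ q (f ℕ.+ (v ℕ.+ (u ℕ.+ c))) f * qbinℕ q (v ℕ.+ (u ℕ.+ c)) v) * qbinℕ q (u ℕ.+ c) u
        ≈⟨ *-congʳ (qbinℕ-qbinℕ-swap f v (u ℕ.+ c)) ⟩
      (qbinℕ q (v ℕ.+ (f ℕ.+ (u ℕ.+ c))) v * qbinℕ q (f ℕ.+ (u ℕ.+ c)) f) * qbinℕ q (u ℕ.+ c) u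
        ≈⟨ trans (*-assoc _ _ _) (*-congˡ (qbinℕ-qbinℕ-swap f u c)) ⟩
      qbinℕ q (v ℕ.+ (f ℕ.+ (u ℕ.+ c))) v * (qbinℕ q (u ℕ.+ (f ℕ.+ c)) u * qbinℕ q (f ℕ.+ c) f)
        ≈⟨ sym (*-assoc _ _ _) ⟩
      qbinℕ q (v ℕ.+ (f ℕ.+ (u ℕ.+ c))) v * qbinℕ q (u ℕ.+ (f ℕ.+ c)) u * qbinℕ q (f ℕ.+ c) f
        ≡⟨ ≡.cong (λ t → qbinℕ q (v ℕ.+ t) v * qbinℕ q (u ℕ.+ (f ℕ.+ c)) u * qbinℕ q (f ℕ.+ c) f) (+-exchange f u c) ⟩
      qbinℕ q (v ℕ.+ (u ℕ.+ (f ℕ.+ c))) v * qbinℕ q (u ℕ.+ (f ℕ.+ c)) u * qbinℕ q (f ℕ.+ c) f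
        ≈⟨ *-congʳ (qbinℕ-qbinℕ-regroup v u (f ℕ.+ c)) ⟨
      qbinℕ q H (v ℕ.+ u) * qbinℕ q (v ℕ.+ u) v * qbinℕ q (f ℕ.+ c) f
        ≡⟨ ≡.cong (λ t → qbinℕ q H (v ℕ.+ u) * qbinℕ q (v ℕ.+ u) v * qbinℕ q t f) (≡.sym (ℕ.m+n∸m≡n (v ℕ.+ u) (f ℕ.+ c))) ⟩
      qbinℕ q H (v ℕ.+ u) * qbinℕ q (v ℕ.+ u) v * qbinℕ q (H ∸ (v ℕ.+ u)) f ∎
      where H = (v ℕ.+ u) ℕ.+ (f ℕ.+ c)

  qbinℕ-pascal : ∀ d g → qbinℕ q (suc d) (suc g) ≈ pow q (suc g) * qbinℕ q d (suc g) + qbinℕ q d g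
  qbinℕ-pascal d g with ℕ.<-cmp g d
  ... | tri< g<d _ _ = ≡.subst (λ t → qbinℕ q (suc t) (suc g) ≈ pow q (suc g) * qbinℕ q t (suc g) + qbinℕ q t g)
                               (ℕ.m+[n∸m]≡n g<d) (interior (d ∸ suc g))
    where
    interior : ∀ e → qbinℕ q (suc (suc (g ℕ.+ e))) (suc g) ≈ pow q (suc g) * qbinℕ q (suc (g ℕ.+ e)) (suc g) + qbinℕ q (suc (g ℕ.+ e)) g
    interior e = begin
      qbinℕ q (suc D) (suc g)
        ≈⟨ qbinℕ-fac (suc g) (suc e) (≡.cong suc (ℕ.+-suc g e)) ⟩
      (fac D * (1# - q * pow q D)) * (fac⁻¹ (suc g) * fac⁻¹ (suc e))
        ≈⟨ *-congʳ (*-congˡ (+-congˡ (-‿cong (*-congˡ (pow-+ q (suc g) e))))) ⟩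
      (fac D * (1# - q * (pow q g * q * pow q e))) * (fac⁻¹ (suc g) * fac⁻¹ (suc e))
        ≈⟨ solve 6 (λ A B C G E Q →
             (A :* (con (+ 1) :- Q :* (G :* Q :* E))) :* (B :* C)
          := (G :* Q) :* (A :* (B :* ((con (+ 1) :- Q :* E) :* C))) :+ A :* (((con (+ 1) :- Q :* G) :* B) :* C)) refl
           (fac D) (fac⁻¹ (suc g)) (fac⁻¹ (suc e)) (pow q g) (pow q e) q ⟩
      pow q (suc g) * (fac D * (fac⁻¹ (suc g) * ((1# - q * pow q e) * fac⁻¹ (suc e))))
        + fac D * (((1# - q * pow q g) * fac⁻¹ (suc g)) * fac⁻¹ (suc e))
        ≈⟨ +-cong (*-congˡ (*-congˡ (*-congˡ (fac⁻¹-suc e)))) (*-congˡ (*-congʳ (fac⁻¹-suc g))) ⟨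
      pow q (suc g) * (fac D * (fac⁻¹ (suc g) * fac⁻¹ e)) + fac D * (fac⁻¹ g * fac⁻¹ (suc e))
        ≈⟨ +-cong (*-congˡ (qbinℕ-fac (suc g) e ≡.refl)) (qbinℕ-fac g (suc e) (ℕ.+-suc g e)) ⟨
      pow q (suc g) * qbinℕ q D (suc g) + qbinℕ q D g ∎
      where D = suc (g ℕ.+ e)
  ... | tri≈ _ ≡.refl _ = begin
    qbinℕ q (suc g) (suc g)                          ≈⟨ trans (qbinℕ-diag (suc g)) (sym (qbinℕ-diag g)) ⟩
    qbinℕ q g g                                      ≈⟨ +-identityˡ _ ⟨
    0# + qbinℕ q g g                                 ≈⟨ +-congʳ (trans (*-congˡ (qbinℕ-> g (suc g) ℕ.≤-refl)) (zeroʳ _)) ⟨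
    pow q (suc g) * qbinℕ q g (suc g) + qbinℕ q g g  ∎
  ... | tri> _ _ d<g = begin
    qbinℕ q (suc d) (suc g)                          ≈⟨ qbinℕ-> (suc d) (suc g) (ℕ.s≤s d<g) ⟩
    0#                                               ≈⟨ +-identityʳ 0# ⟨
    0# + 0#                                          ≈⟨ +-cong (trans (*-congˡ (qbinℕ-> d (suc g) (ℕ.m≤n⇒m≤1+n d<g))) (zeroʳ _))
                                                               (qbinℕ-> d g d<g) ⟨
    pow q (suc g) * qbinℕ q d (suc g) + qbinℕ q d g  ∎

  kernelWeight : Carrier → ℕ → ℕ → Carrier
  kernelWeight w f k = pow w f * pow q (f ℕ.* f) * poch q (w * pow q (suc f)) k

  kernelTerm : ℕ → Carrier → ℕ → Carrier
  kernelTerm d w f = qbinℕ q d f * kernelWeight w f (d ∸ f)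

  -- Pascal's rule splits the terms for d + 1 into two families which, after
  -- shifting one of them, recombine into the terms for d with w replaced by w q.
  module KernelStep (d : ℕ) (w : Carrier) where
    pascalLeft : ℕ → Carrier
    pascalLeft f = pow q f * (qbinℕ q d f * kernelWeight w f (suc d ∸ f))

    pascalRight : ℕ → Carrier
    pascalRight ℕ.zero = 0#
    pascalRight (suc g) = qbinℕ q d g * kernelWeight w (suc g) (d ∸ g)

    kernelTerm-split : ∀ f → kernelTerm (suc d) w f ≈ pascalLeft f + pascalRight f
    kernelTerm-split ℕ.zero = begin
      qbinℕ q (suc d) 0 * kernelWeight w 0 (suc d)  ≈⟨ *-congʳ (trans (qbinℕ-0 (suc d)) (sym (qbinℕ-0 d))) ⟩
      qbinℕ q d 0 * kernelWeight w 0 (suc d)        ≈⟨ *-identityˡ _ ⟨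
      pascalLeft 0                                  ≈⟨ +-identityʳ _ ⟨
      pascalLeft 0 + pascalRight 0                  ∎
    kernelTerm-split (suc g) = begin
      qbinℕ q (suc d) (suc g) * W
        ≈⟨ *-congʳ (qbinℕ-pascal d g) ⟩
      (pow q (suc g) * qbinℕ q d (suc g) + qbinℕ q d g) * W
        ≈⟨ distribʳ _ _ _ ⟩
      (pow q (suc g) * qbinℕ q d (suc g)) * W + qbinℕ q d g * W
        ≈⟨ +-congʳ (*-assoc _ _ _) ⟩
      pascalLeft (suc g) + pascalRight (suc g) ∎
      where W = kernelWeight w (suc g) (d ∸ g)

    pascal-recombine : ∀ f → pascalLeft f + pascalRight (suc f) ≈ kernelTerm d (w * q) f
    pascal-recombine f with ℕ.≤-<-connex f d
    ... | inj₂ d<f = begin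
      pow q f * (qbinℕ q d f * kernelWeight w f (suc d ∸ f)) + qbinℕ q d f * kernelWeight w (suc f) (d ∸ f)
        ≈⟨ +-cong (*-congˡ (*-congʳ (qbinℕ-> d f d<f))) (*-congʳ (qbinℕ-> d f d<f)) ⟩
      pow q f * (0# * kernelWeight w f (suc d ∸ f)) + 0# * kernelWeight w (suc f) (d ∸ f)
        ≈⟨ +-cong (trans (*-congˡ (zeroˡ _)) (zeroʳ _)) (zeroˡ _) ⟩
      0# + 0#                                        ≈⟨ +-identityʳ 0# ⟩
      0#                                             ≈⟨ zeroˡ _ ⟨
      0# * kernelWeight (w * q) f (d ∸ f)            ≈⟨ *-congʳ (qbinℕ-> d f d<f) ⟨
      qbinℕ q d f * kernelWeight (w * q) f (d ∸ f)   ∎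
    ... | inj₁ f≤d = begin
      pow q f * (Qb * (W * S * poch q y (suc d ∸ f))) + Qb * (pow w (suc f) * pow q (suc f ℕ.* suc f) * Rk)
        ≡⟨ ≡.cong (λ t → pow q f * (Qb * (W * S * poch q y t)) + Qb * (pow w (suc f) * pow q (suc f ℕ.* suc f) * Rk))
                  (ℕ.+-∸-assoc 1 f≤d) ⟩
      pow q f * (Qb * (W * S * poch q y (suc k))) + Qb * (pow w (suc f) * pow q (suc f ℕ.* suc f) * Rk)
        ≈⟨ +-cong (*-congˡ (*-congˡ (*-congˡ (trans (poch-suc-head q y k) (*-congˡ (poch-cong q k (*-assoc _ _ _)))))))
                  (*-congˡ (*-congʳ (*-congˡ (pow-square-suc q f)))) ⟩
      pow q f * (Qb * (W * S * ((1# - w * X) * Rk))) + Qb * (W * w * (S * (pow q f * X)) * Rk)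
        ≈⟨ solve 7 (λ P Qb W S w X Rk → P :* (Qb :* (W :* S :* ((con (+ 1) :- w :* X) :* Rk))) :+ Qb :* (W :* w :* (S :* (P :* X)) :* Rk)
                 := Qb :* ((W :* P) :* S :* Rk)) refl (pow q f) Qb W S w X Rk ⟩
      Qb * ((W * pow q f) * S * Rk)
        ≈⟨ *-congˡ (sym (*-cong (*-congʳ (pow-* w q f)) (poch-cong q k (solve 3 (λ w q X → w :* q :* X := w :* (X :* q)) refl w q X)))) ⟩
      Qb * (pow (w * q) f * S * poch q (w * q * pow q (suc f)) k) ∎
      where
      Qb = qbinℕ q d f
      W = pow w f
      S = pow q (f ℕ.* f)
      X = pow q (suc f)
      y = w * X
      k = d ∸ f
      Rk = poch q (w * pow q (suc (suc f))) k

  kernelTerm-sum : ∀ d N w → d ℕ.≤ N → sumTo N (kernelTerm d w) ≈ 1#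
  kernelTerm-sum ℕ.zero N w _ = begin
    sumTo N (kernelTerm 0 w)  ≈⟨ sumTo-only0 N (kernelTerm 0 w) (λ j → trans (*-congʳ (qbinℕ-> 0 (suc j) (ℕ.s≤s ℕ.z≤n))) (zeroˡ _)) ⟩
    qbinℕ q 0 0 * (1# * 1# * 1#)  ≈⟨ *-cong (qbinℕ-0 0) (trans (*-identityʳ _) (*-identityʳ _)) ⟩
    1# * 1#                   ≈⟨ *-identityʳ _ ⟩
    1#                        ∎
  kernelTerm-sum (suc d) (suc N) w (ℕ.s≤s d≤N) = begin
    sumTo (suc N) (kernelTerm (suc d) w)
      ≈⟨ sumTo-cong (suc N) kernelTerm-split ⟩
    sumTo (suc N) (λ f → pascalLeft f + pascalRight f)
      ≈⟨ sumTo-+ (suc N) pascalLeft pascalRight ⟩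
    (sumTo N pascalLeft + pascalLeft (suc N)) + sumTo (suc N) pascalRight
      ≈⟨ +-cong (sumTo-last0 N left-last≈0) (trans (sumTo-head N pascalRight) (+-identityˡ _)) ⟩
    sumTo N pascalLeft + sumTo N (λ f → pascalRight (suc f))
      ≈⟨ sumTo-+ N pascalLeft _ ⟨
    sumTo N (λ f → pascalLeft f + pascalRight (suc f))
      ≈⟨ sumTo-cong N pascal-recombine ⟩
    sumTo N (kernelTerm d (w * q))
      ≈⟨ sumTo-last0 N (trans (*-congʳ (qbinℕ-> d (suc N) (ℕ.s≤s d≤N))) (zeroˡ _)) ⟨
    sumTo (suc N) (kernelTerm d (w * q))
      ≈⟨ kernelTerm-sum d (suc N) (w * q) (ℕ.m≤n⇒m≤1+n d≤N) ⟩
    1# ∎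
    where
    open KernelStep d w
    left-last≈0 : pascalLeft (suc N) ≈ 0#
    left-last≈0 = trans (*-congˡ (trans (*-congʳ (qbinℕ-> d (suc N) (ℕ.s≤s d≤N))) (zeroˡ _))) (zeroʳ _)

  qbin-bottom<0 : ∀ x a b → a ℕ.< b → qbin q x (+ a ℤ.- + b) ≈ 0#
  qbin-bottom<0 x a b a<b with +m-+n≡-[1+k] a b a<b
  ... | k , ≡k = ≡.subst (λ t → qbin q x t ≈ 0#) (≡.sym ≡k) (bottom-negative x k)
    where
    bottom-negative : ∀ x k → qbin q x -[1+ k ] ≈ 0#
    bottom-negative (+ _)    k = refl
    bottom-negative -[1+ _ ] k = refl

  qbin-top<0 : ∀ y a b → a ℕ.< b → qbin q (+ a ℤ.- + b) y ≈ 0#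
  qbin-top<0 y a b a<b with +m-+n≡-[1+k] a b a<b
  ... | k , ≡k = ≡.subst (λ t → qbin q t y ≈ 0#) (≡.sym ≡k) refl

  Φ-ascent : ∀ {s} (z : Fin s → Carrier) (m : Fin s → ℕ) i → m i ℕ.< nxt m i → Φ z q m ≈ 0#
  Φ-ascent z m i ascent = prodFin-0 _ i (trans (*-congˡ (qbinℕ-> (m i) (nxt m i) ascent)) (zeroʳ _))

  K-ascent : ∀ {s} (z : Fin s → Carrier) (n m : Fin s → ℕ) i → n i ℕ.< nxt n i → K z q n m ≈ 0#
  K-ascent z n m i ascent = trans (*-congˡ (prodFin-0 _ i (trans (*-congˡ (qbin-bottom<0 (+ at n 0 ℤ.- + nxt n i ℤ.- + at m 0 ℤ.+ + m i) (n i) (nxt n i) ascent)) (zeroʳ _))))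
                                  (zeroʳ _)

  K-head> : ∀ {s} (z : Fin s → Carrier) (n m : Fin s → ℕ) → at n 0 ℕ.< at m 0 → K z q n m ≈ 0#
  K-head> z n m n₁<m₁ = trans (*-congʳ (qbinℕ-> (at n 0) (at m 0) n₁<m₁)) (zeroˡ _)

  -- x is not of the form q⁻ᵏ with k ≥ 1, so no (x q)_k vanishes.
  Generic : Carrier → Set ℓ
  Generic x = ∀ k → ¬ (x * pow q (suc k) ≈ 1#)

  generic-*qᶠ : ∀ x f → Generic x → Generic (x * pow q f)
  generic-*qᶠ x f x-generic k xqᶠqᵏ⁺¹≈1 = x-generic (f ℕ.+ k) (begin
    x * pow q (suc (f ℕ.+ k))       ≡⟨ ≡.cong (λ t → x * pow q t) (ℕ.+-suc f k) ⟨
    x * pow q (f ℕ.+ suc k)         ≈⟨ *-congˡ (pow-+ q f (suc k)) ⟩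
    x * (pow q f * pow q (suc k))   ≈⟨ *-assoc _ _ _ ⟨
    x * pow q f * pow q (suc k)     ≈⟨ xqᶠqᵏ⁺¹≈1 ⟩
    1#                              ∎)

  poch-generic-≉0 : ∀ x → Generic x → ∀ n → ¬ (poch q (x * q) n ≈ 0#)
  poch-generic-≉0 x x-generic n = poch-≉0 q (x * q) n
    (λ k _ xqqᵏ≈1 → x-generic k (trans (*-congˡ (*-comm _ _)) (trans (sym (*-assoc _ _ _)) xqqᵏ≈1)))

  x*qᶠ*q≈x*q*qᶠ : ∀ x f → x * pow q f * q ≈ x * q * pow q f
  x*qᶠ*q≈x*q*qᶠ x f = solve 3 (λ x p q → x :* p :* q := x :* q :* p) refl x (pow q f) q

  inv-poch-+ : ∀ x f k → Generic x →
    inv (poch q (x * q) (f ℕ.+ k)) ≈ inv (poch q (x * q) f) * inv (poch q (x * pow q f * q) k)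
  inv-poch-+ x f k x-generic = begin
    inv (poch q (x * q) (f ℕ.+ k))                          ≈⟨ inv-cong (poch-+ q (x * q) f k) ⟩
    inv (poch q (x * q) f * poch q (x * q * pow q f) k)    ≈⟨ inv-cong (*-congˡ (poch-cong q k (x*qᶠ*q≈x*q*qᶠ x f))) ⟨
    inv (poch q (x * q) f * poch q (x * pow q f * q) k)    ≈⟨ inv-* _ _ (poch-generic-≉0 x x-generic f)
                                                                    (poch-generic-≉0 _ (generic-*qᶠ x f x-generic) k) ⟩
    inv (poch q (x * q) f) * inv (poch q (x * pow q f * q) k) ∎

  inv-pochℤ-shift : ∀ x f A v → Generic x → v ℕ.≤ A →
    inv (pochℤ q (x * pow q f * q) (+ A ℤ.- + v)) * inv (poch q (x * q) f) ≈ inv (pochℤ q (x * q) (+ (f ℕ.+ A) ℤ.- + v))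
  inv-pochℤ-shift x f A v x-generic v≤A = begin
    inv (pochℤ q (x * pow q f * q) (+ A ℤ.- + v)) * inv (poch q (x * q) f)
      ≡⟨ ≡.cong (λ t → inv (pochℤ q (x * pow q f * q) t) * inv (poch q (x * q) f)) (+m-+n≡+[m∸n] A v v≤A) ⟩
    inv (poch q (x * pow q f * q) (A ∸ v)) * inv (poch q (x * q) f)
      ≈⟨ trans (*-comm _ _) (sym (inv-poch-+ x f (A ∸ v) x-generic)) ⟩
    inv (poch q (x * q) (f ℕ.+ (A ∸ v)))
      ≡⟨ ≡.cong (λ t → inv (pochℤ q (x * q) t))
                (≡.sym (≡.trans (+m-+n≡+[m∸n] (f ℕ.+ A) v (ℕ.≤-trans v≤A (ℕ.m≤n+m A f))) (≡.cong +_ (ℕ.+-∸-assoc f v≤A)))) ⟩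
    inv (pochℤ q (x * q) (+ (f ℕ.+ A) ℤ.- + v)) ∎

  inv-poch*tail : ∀ x f d → Generic x → f ℕ.≤ d →
    inv (poch q (x * q) d) * poch q (x * pow q (suc f)) (d ∸ f) ≈ inv (poch q (x * q) f)
  inv-poch*tail x f d x-generic f≤d = begin
    inv (poch q (x * q) d) * tail
      ≡⟨ ≡.cong (λ t → inv (poch q (x * q) t) * tail) (≡.sym (ℕ.m+[n∸m]≡n f≤d)) ⟩
    inv (poch q (x * q) (f ℕ.+ k)) * tail
      ≈⟨ *-congʳ (inv-poch-+ x f k x-generic) ⟩
    inv (poch q (x * q) f) * inv (poch q (x * pow q f * q) k) * tail
      ≈⟨ *-assoc _ _ _ ⟩
    inv (poch q (x * q) f) * (inv (poch q (x * pow q f * q) k) * tail)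
      ≈⟨ *-congˡ (*-congˡ (poch-cong q k (solve 3 (λ x p q → x :* (p :* q) := x :* p :* q) refl x (pow q f) q))) ⟩
    inv (poch q (x * q) f) * (inv (poch q (x * pow q f * q) k) * poch q (x * pow q f * q) k)
      ≈⟨ *-congˡ (inv-l _ (poch-generic-≉0 _ (generic-*qᶠ x f x-generic) k)) ⟩
    inv (poch q (x * q) f) * 1#
      ≈⟨ *-identityʳ _ ⟩
    inv (poch q (x * q) f) ∎
    where
    k = d ∸ f
    tail = poch q (x * pow q (suc f)) k

  AllGeneric : ∀ {s} → (Fin s → Carrier) → Set ℓ
  AllGeneric z = ∀ i → Generic (z i)

  reducedZ : ∀ {s} → (Fin (suc s) → Carrier) → ℕ → Fin s → Carrier
  reducedZ z f i = z (suc i) * pow q f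

  reducedN : ∀ {s} → (Fin (suc s) → ℕ) → ℕ → Fin s → ℕ
  reducedN {ℕ.zero} n f ()
  reducedN {suc s}  n f zero    = n zero ∸ f
  reducedN {suc s}  n f (suc i) = n (suc (suc i))

  reductionBinom : ∀ {s} → (Fin (suc s) → ℕ) → ℕ → Carrier
  reductionBinom n f = qbin q (+ at n 0 ℤ.- + at n 2 ℤ.- + f) (+ at n 1 ℤ.- + at n 2)

  reductionCoeff : ∀ {s} → (Fin (suc s) → Carrier) → (Fin (suc s) → ℕ) → ℕ → Carrier
  reductionCoeff z n f = qbinℕ q (n zero) f * pow (z zero) f * pow q (f ℕ.* f) * inv (poch q (z zero * q) f)
                         * reductionBinom n f * prodFin (λ i → inv (poch q (z (suc i) * q) f))

  prodFin-zpow-telescope : ∀ {s} (y : Fin s → Carrier) (c : Carrier) (m : Fin s → ℕ) → Decreasing m →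
    prodFin (λ i → zpow (y i) (+ m i ℤ.- + nxt m i)) * pow c (at m 0) ≈ prodFin (λ i → zpow (y i * c) (+ m i ℤ.- + nxt m i))
  prodFin-zpow-telescope {ℕ.zero} y c m _ = *-identityˡ 1#
  prodFin-zpow-telescope {suc s}  y c m (m₂≤m₁ , dec) = begin
    (zpow y₁ (+ m₁ ℤ.- + m₂) * Π) * pow c m₁        ≡⟨ ≡.cong (λ t → (zpow y₁ t * Π) * pow c m₁) (+m-+n≡+[m∸n] m₁ m₂ m₂≤m₁) ⟩
    (pow y₁ e * Π) * pow c m₁                       ≡⟨ ≡.cong (λ t → (pow y₁ e * Π) * pow c t) (≡.sym (ℕ.m∸n+n≡m m₂≤m₁)) ⟩
    (pow y₁ e * Π) * pow c (e ℕ.+ m₂)               ≈⟨ *-congˡ (pow-+ c e m₂) ⟩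
    (pow y₁ e * Π) * (pow c e * pow c m₂)           ≈⟨ solve 4 (λ Y R C B → (Y :* R) :* (C :* B) := (Y :* C) :* (R :* B)) refl _ _ _ _ ⟩
    (pow y₁ e * pow c e) * (Π * pow c m₂)           ≈⟨ *-cong (sym (pow-* _ _ e)) (prodFin-zpow-telescope (λ i → y (suc i)) c (λ i → m (suc i)) dec) ⟩
    pow (y₁ * c) e * Π′                             ≡⟨ ≡.cong (λ t → zpow (y₁ * c) t * Π′) (≡.sym (+m-+n≡+[m∸n] m₁ m₂ m₂≤m₁)) ⟩
    zpow (y₁ * c) (+ m₁ ℤ.- + m₂) * Π′              ∎
    where
    y₁ = y zero
    m₁ = m zero
    m₂ = at (λ i → m (suc i)) 0
    e = m₁ ∸ m₂
    Π = prodFin (λ i → zpow (y (suc i)) (+ m (suc i) ℤ.- + nxt m (suc i)))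
    Π′ = prodFin (λ i → zpow (y (suc i) * c) (+ m (suc i) ℤ.- + nxt m (suc i)))

  K-binomials-reduce : ∀ {s} (n m : Fin (suc s) → ℕ) f → f ℕ.≤ n zero →
    m zero ≡ at (λ i → m (suc i)) 0 ℕ.+ f →
    prodFin (λ i → qbin q (+ at n 0 ℤ.- + nxt n (suc i) ℤ.- + at m 0 ℤ.+ + m (suc i)) (+ n (suc i) ℤ.- + nxt n (suc i)))
    ≈ reductionBinom n f * prodFin (λ i → qbin q (+ at (reducedN n f) 0 ℤ.- + nxt (reducedN n f) i ℤ.- + at (λ j → m (suc j)) 0 ℤ.+ + m (suc i))
                                                 (+ reducedN n f i ℤ.- + nxt (reducedN n f) i))
  K-binomials-reduce {ℕ.zero} n m f f≤h _ = sym (trans (*-identityʳ _) (begin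
    qbin q (+ n zero ℤ.- + 0 ℤ.- + f) (+ 0)  ≡⟨ ≡.cong (λ t → qbin q t (+ 0)) (≡.trans (h-v-f≡[h∸f]-v (n zero) 0 f f≤h) (ℤ.+-identityʳ (+ (n zero ∸ f)))) ⟩
    qbinℕ q (n zero ∸ f) 0                   ≈⟨ qbinℕ-0 (n zero ∸ f) ⟩
    1#                                       ∎))
  K-binomials-reduce {suc s} n m f f≤h m₁≡a+f = begin
    qbin q (+ h ℤ.- + n₃ ℤ.- + m zero ℤ.+ + a) (+ n₂ ℤ.- + n₃) * Π
      ≡⟨ ≡.cong (λ t → qbin q t (+ n₂ ℤ.- + n₃) * Π) first-top ⟩
    reductionBinom n f * Π
      ≈⟨ *-congˡ (prodFin-cong (λ i → reflexive (≡.cong (λ t → qbin q t (+ n (suc (suc i)) ℤ.- + nxt n (suc (suc i))))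
                                                          (later-top i)))) ⟩
    reductionBinom n f * Π′
      ≈⟨ absorb ⟩
    reductionBinom n f * (qbin q (+ (h ∸ f) ℤ.- + n₃ ℤ.- + a ℤ.+ + a) (+ (h ∸ f) ℤ.- + n₃) * Π′) ∎
    where
    h = n zero
    n₂ = n (suc zero)
    n₃ = at (λ i → n (suc (suc i))) 0
    a = m (suc zero)
    Π = prodFin (λ i → qbin q (+ h ℤ.- + nxt n (suc (suc i)) ℤ.- + m zero ℤ.+ + m (suc (suc i)))
                              (+ n (suc (suc i)) ℤ.- + nxt n (suc (suc i))))
    Π′ = prodFin (λ i → qbin q (+ (h ∸ f) ℤ.- + nxt n (suc (suc i)) ℤ.- + a ℤ.+ + m (suc (suc i)))
                               (+ n (suc (suc i)) ℤ.- + nxt n (suc (suc i))))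
    first-top : + h ℤ.- + n₃ ℤ.- + m zero ℤ.+ + a ≡ + h ℤ.- + n₃ ℤ.- + f
    first-top = ≡.trans (≡.cong (λ t → + h ℤ.- + n₃ ℤ.- t ℤ.+ + a) (≡.trans (≡.cong +_ m₁≡a+f) (ℤ.pos-+ a f)))
                        (x-v-[a+f]+a≡x-v-f (+ h) (+ n₃) (+ a) (+ f))
    later-top : ∀ i → + h ℤ.- + nxt n (suc (suc i)) ℤ.- + m zero ℤ.+ + m (suc (suc i))
                    ≡ + (h ∸ f) ℤ.- + nxt n (suc (suc i)) ℤ.- + a ℤ.+ + m (suc (suc i))
    later-top i = ≡.trans (≡.cong (λ t → + h ℤ.- + nxt n (suc (suc i)) ℤ.- + t ℤ.+ + m (suc (suc i))) m₁≡a+f)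
                          (h-v-[a+f]+w≡[h∸f]-v-a+w h (nxt n (suc (suc i))) a f (m (suc (suc i))) f≤h)
    absorb : reductionBinom n f * Π′ ≈ reductionBinom n f * (qbin q (+ (h ∸ f) ℤ.- + n₃ ℤ.- + a ℤ.+ + a) (+ (h ∸ f) ℤ.- + n₃) * Π′)
    absorb with ℕ.≤-<-connex n₃ (h ∸ f)
    ... | inj₁ n₃≤h∸f = *-congˡ (sym (trans (*-congʳ diag≈1) (*-identityˡ _)))
      where
      diag≈1 : qbin q (+ (h ∸ f) ℤ.- + n₃ ℤ.- + a ℤ.+ + a) (+ (h ∸ f) ℤ.- + n₃) ≈ 1#
      diag≈1 = trans (reflexive (≡.cong₂ (qbin q) (≡.trans (x-v-a+a≡x-v (+ (h ∸ f)) (+ n₃) (+ a)) ≡h∸f∸n₃) ≡h∸f∸n₃))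
                     (qbinℕ-diag (h ∸ f ∸ n₃))
        where ≡h∸f∸n₃ = +m-+n≡+[m∸n] (h ∸ f) n₃ n₃≤h∸f
    ... | inj₂ h∸f<n₃ = trans (trans (*-congʳ binom≈0) (zeroˡ _)) (sym (trans (*-congʳ binom≈0) (zeroˡ _)))
      where
      binom≈0 : reductionBinom n f ≈ 0#
      binom≈0 = ≡.subst (λ t → qbin q t (+ n₂ ℤ.- + n₃) ≈ 0#) (≡.sym (h-v-f≡[h∸f]-v h n₃ f f≤h))
                        (qbin-top<0 _ (h ∸ f) n₃ h∸f<n₃)

  qbin-reducedN-head : ∀ {s} (n : Fin (suc s) → ℕ) f (m′ : Fin s → ℕ) →
    qbin q (+ at (reducedN n f) 0) (+ at m′ 0) ≈ qbinℕ q (n zero ∸ f) (at m′ 0)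
  qbin-reducedN-head {ℕ.zero} n f m′ = trans (qbinℕ-0 0) (sym (qbinℕ-0 (n zero ∸ f)))
  qbin-reducedN-head {suc s}  n f m′ = refl

  module Peel {s} (z : Fin (suc s) → Carrier) (n m : Fin (suc s) → ℕ) (f : ℕ) where
    h : ℕ
    h = n zero
    z₁ : Carrier
    z₁ = z zero
    m′ : Fin s → ℕ
    m′ i = m (suc i)
    a : ℕ
    a = at m′ 0
    z′ : Fin s → Carrier
    z′ = reducedZ z f
    n′ : Fin s → ℕ
    n′ = reducedN n f

    zpowTerm : Fin s → Carrier
    zpowTerm i = zpow (z (suc i)) (+ m′ i ℤ.- + nxt m′ i)

    zpowTerm′ : Fin s → Carrier
    zpowTerm′ i = zpow (z′ i) (+ m′ i ℤ.- + nxt m′ i)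

    qpowTerm : Fin s → Carrier
    qpowTerm i = zpow q (+ m′ i ℤ.* + m′ i ℤ.- + m′ i ℤ.* + nxt m′ i)

    binomTerm : Fin s → Carrier
    binomTerm i = qbin q (+ at n 0 ℤ.- + nxt n (suc i) ℤ.- + at m 0 ℤ.+ + m′ i) (+ n (suc i) ℤ.- + nxt n (suc i))

    binomTerm′ : Fin s → Carrier
    binomTerm′ i = qbin q (+ at n′ 0 ℤ.- + nxt n′ i ℤ.- + a ℤ.+ + m′ i) (+ n′ i ℤ.- + nxt n′ i)

    pochTerm : Fin s → Carrier
    pochTerm i = inv (pochℤ q (z (suc i) * q) (+ m zero ℤ.- + nxt m′ i))

    pochTerm′ : Fin s → Carrier
    pochTerm′ i = inv (pochℤ q (z′ i * q) (+ a ℤ.- + nxt m′ i))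

    pochPrefix : Fin s → Carrier
    pochPrefix i = inv (poch q (z (suc i) * q) f)

    binomΦTerm : Fin s → Carrier
    binomΦTerm i = qbin q (+ m′ i) (+ nxt m′ i)

    reducedKBody : Carrier
    reducedKBody = prodFin zpowTerm′ * prodFin qpowTerm * prodFin binomTerm′

    K-reduced : K z′ q n′ m′ ≈ qbinℕ q (h ∸ f) a * reducedKBody
    K-reduced = *-cong (qbin-reducedN-head n f m′)
                       (trans (prodFin-* (λ i → zpowTerm′ i * qpowTerm i) binomTerm′) (*-congʳ (prodFin-* zpowTerm′ qpowTerm)))

    K-peel : Decreasing n → f ℕ.≤ h → Decreasing m′ → m zero ≡ a ℕ.+ f →
      K z q n m ≈ qbinℕ q h (m zero) * ((pow z₁ f * pow q (f ℕ.* f) * reductionBinom n f) * reducedKBody)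
    K-peel (n₂≤h , _) f≤h dec-m′ m₁≡a+f = *-congˡ (begin
      (zpow z₁ (+ m zero ℤ.- + a) * zpow q (+ m zero ℤ.* + m zero ℤ.- + m zero ℤ.* + a) * B₁)
        * prodFin (λ i → zpowTerm i * qpowTerm i * binomTerm i)
        ≈⟨ *-cong (*-cong (*-cong z-power q-power) B₁≈1) binomials ⟩
      (pow z₁ f * (pow q (f ℕ.* f) * pow q (f ℕ.* a)) * 1#)
        * ((prodFin zpowTerm * prodFin qpowTerm) * (reductionBinom n f * prodFin binomTerm′))
        ≈⟨ solve 7 (λ Z S Fa B ΠZ ΠQ ΠB′ → (Z :* (S :* Fa) :* con (+ 1)) :* ((ΠZ :* ΠQ) :* (B :* ΠB′))
                                           := (Z :* S :* B) :* ((ΠZ :* Fa) :* ΠQ :* ΠB′)) refl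
                   (pow z₁ f) (pow q (f ℕ.* f)) (pow q (f ℕ.* a)) (reductionBinom n f)
                   (prodFin zpowTerm) (prodFin qpowTerm) (prodFin binomTerm′) ⟩
      (pow z₁ f * pow q (f ℕ.* f) * reductionBinom n f) * ((prodFin zpowTerm * pow q (f ℕ.* a)) * prodFin qpowTerm * prodFin binomTerm′)
        ≈⟨ *-congˡ (*-congʳ (*-congʳ telescope)) ⟩
      (pow z₁ f * pow q (f ℕ.* f) * reductionBinom n f) * reducedKBody ∎)
      where
      n₂ = at (λ i → n (suc i)) 0
      B₁ = qbin q (+ h ℤ.- + n₂ ℤ.- + m zero ℤ.+ + m zero) (+ h ℤ.- + n₂)
      z-power : zpow z₁ (+ m zero ℤ.- + a) ≈ pow z₁ f
      z-power = reflexive (≡.cong (zpow z₁) (≡.trans (≡.cong (λ t → + t ℤ.- + a) m₁≡a+f) ([a+f]-a≡f a f)))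
      q-power : zpow q (+ m zero ℤ.* + m zero ℤ.- + m zero ℤ.* + a) ≈ pow q (f ℕ.* f) * pow q (f ℕ.* a)
      q-power = trans (reflexive (≡.cong (zpow q) (≡.trans (≡.cong (λ t → + t ℤ.* + t ℤ.- + t ℤ.* + a) m₁≡a+f)
                                                              ([a+f]²-[a+f]a≡+[f²+fa] a f))))
                      (pow-+ q (f ℕ.* f) (f ℕ.* a))
      B₁≈1 : B₁ ≈ 1#
      B₁≈1 = trans (reflexive (≡.cong₂ (qbin q) (≡.trans (x-v-a+a≡x-v (+ h) (+ n₂) (+ m zero)) ≡h∸n₂) ≡h∸n₂))
                   (qbinℕ-diag (h ∸ n₂))
        where ≡h∸n₂ = +m-+n≡+[m∸n] h n₂ n₂≤h
      binomials : prodFin (λ i → zpowTerm i * qpowTerm i * binomTerm i)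
                  ≈ (prodFin zpowTerm * prodFin qpowTerm) * (reductionBinom n f * prodFin binomTerm′)
      binomials = trans (prodFin-* (λ i → zpowTerm i * qpowTerm i) binomTerm)
                        (*-cong (prodFin-* zpowTerm qpowTerm) (K-binomials-reduce n m f f≤h m₁≡a+f))
      telescope : prodFin zpowTerm * pow q (f ℕ.* a) ≈ prodFin zpowTerm′
      telescope = trans (*-congˡ (pow-pow q f a)) (prodFin-zpow-telescope (λ i → z (suc i)) (pow q f) m′ dec-m′)

    Φ-peel : AllGeneric z → Decreasing m′ → m zero ≡ a ℕ.+ f →
      Φ z q m ≈ (inv (poch q (z₁ * q) f) * qbinℕ q (m zero) a * prodFin pochPrefix) * Φ z′ q m′
    Φ-peel z-generic dec-m′ m₁≡a+f = begin
      (inv (pochℤ q (z₁ * q) (+ m zero ℤ.- + a)) * qbinℕ q (m zero) a) * prodFin (λ i → pochTerm i * binomΦTerm i)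
        ≈⟨ *-cong (*-congʳ first-poch) (prodFin-cong (λ i → trans (*-congʳ (pochTerm-split i)) (*-assoc _ _ _))) ⟩
      (inv (poch q (z₁ * q) f) * qbinℕ q (m zero) a) * prodFin (λ i → pochPrefix i * (pochTerm′ i * binomΦTerm i))
        ≈⟨ *-congˡ (prodFin-* pochPrefix _) ⟩
      (inv (poch q (z₁ * q) f) * qbinℕ q (m zero) a) * (prodFin pochPrefix * Φ z′ q m′)
        ≈⟨ *-assoc _ _ _ ⟨
      (inv (poch q (z₁ * q) f) * qbinℕ q (m zero) a * prodFin pochPrefix) * Φ z′ q m′ ∎
      where
      first-poch : inv (pochℤ q (z₁ * q) (+ m zero ℤ.- + a)) ≈ inv (poch q (z₁ * q) f)
      first-poch = reflexive (≡.cong (λ t → inv (pochℤ q (z₁ * q) t))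
                                     (≡.trans (≡.cong (λ t → + t ℤ.- + a) m₁≡a+f) ([a+f]-a≡f a f)))
      pochTerm-split : ∀ i → pochTerm i ≈ pochPrefix i * pochTerm′ i
      pochTerm-split i = begin
        pochTerm i
          ≡⟨ ≡.cong (λ t → inv (pochℤ q (z (suc i) * q) (+ t ℤ.- + nxt m′ i))) (≡.trans m₁≡a+f (ℕ.+-comm a f)) ⟩
        inv (pochℤ q (z (suc i) * q) (+ (f ℕ.+ a) ℤ.- + nxt m′ i))
          ≈⟨ inv-pochℤ-shift (z (suc i)) f a (nxt m′ i) (z-generic (suc i)) (decreasing-next≤head m′ dec-m′ i) ⟨
        pochTerm′ i * pochPrefix i
          ≈⟨ *-comm _ _ ⟩
        pochPrefix i * pochTerm′ i ∎

    KΦ-peel : AllGeneric z → Decreasing n → f ℕ.≤ h → Decreasing m′ → m zero ≡ a ℕ.+ f →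
      K z q n m * Φ z q m ≈ reductionCoeff z n f * (K z′ q n′ m′ * Φ z′ q m′)
    KΦ-peel z-generic dec-n f≤h dec-m′ m₁≡a+f = begin
      K z q n m * Φ z q m
        ≈⟨ *-cong (K-peel dec-n f≤h dec-m′ m₁≡a+f) (Φ-peel z-generic dec-m′ m₁≡a+f) ⟩
      (qbinℕ q h (m zero) * (Z * S * B * Kb)) * ((ip * qbinℕ q (m zero) a * ΠI) * Φ′)
        ≈⟨ solve 9 (λ Hm Ma Z S B Kb ip ΠI Φ′ → (Hm :* (Z :* S :* B :* Kb)) :* ((ip :* Ma :* ΠI) :* Φ′)
                                              := (Hm :* Ma) :* ((Z :* S :* ip :* B :* ΠI) :* (Kb :* Φ′))) refl
                   (qbinℕ q h (m zero)) (qbinℕ q (m zero) a) Z S B Kb ip ΠI Φ′ ⟩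
      (qbinℕ q h (m zero) * qbinℕ q (m zero) a) * ((Z * S * ip * B * ΠI) * (Kb * Φ′))
        ≈⟨ *-congʳ (trans (reflexive (≡.cong (λ t → qbinℕ q h t * qbinℕ q t a) m₁≡a+f)) (qbinℕ-nested h f a f≤h)) ⟩
      (qbinℕ q h f * qbinℕ q (h ∸ f) a) * ((Z * S * ip * B * ΠI) * (Kb * Φ′))
        ≈⟨ solve 9 (λ Hf Ha Z S ip B ΠI Kb Φ′ → (Hf :* Ha) :* ((Z :* S :* ip :* B :* ΠI) :* (Kb :* Φ′))
                                             := (Hf :* Z :* S :* ip :* B :* ΠI) :* ((Ha :* Kb) :* Φ′)) refl
                   (qbinℕ q h f) (qbinℕ q (h ∸ f) a) Z S ip B ΠI Kb Φ′ ⟩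
      reductionCoeff z n f * ((qbinℕ q (h ∸ f) a * Kb) * Φ′)
        ≈⟨ *-congˡ (*-congʳ K-reduced) ⟨
      reductionCoeff z n f * (K z′ q n′ m′ * Φ′) ∎
      where
      Z = pow z₁ f
      S = pow q (f ℕ.* f)
      B = reductionBinom n f
      Kb = reducedKBody
      ip = inv (poch q (z₁ * q) f)
      ΠI = prodFin pochPrefix
      Φ′ = Φ z′ q m′

  KΦ-factor : ∀ {s} (z : Fin (suc s) → Carrier) (n m : Fin (suc s) → ℕ) (f : ℕ) →
    AllGeneric z → Decreasing n → m zero ≡ at (λ i → m (suc i)) 0 ℕ.+ f →
    K z q n m * Φ z q m ≈ reductionCoeff z n f * (K (reducedZ z f) q (reducedN n f) (λ i → m (suc i)) * Φ (reducedZ z f) q (λ i → m (suc i)))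
  KΦ-factor z n m f z-generic dec-n m₁≡a+f with ℕ.≤-<-connex f (n zero) | decreasing? (λ i → m (suc i))
  ... | inj₁ f≤h | inj₁ dec-m′ = Peel.KΦ-peel z n m f z-generic dec-n f≤h dec-m′ m₁≡a+f
  ... | inj₁ _   | inj₂ (i , ascent) =
    trans (*-≈0ʳ _ (Φ-ascent z m (suc i) ascent))
          (sym (*-≈0ʳ _ (*-≈0ʳ _ (Φ-ascent (reducedZ z f) (λ j → m (suc j)) i ascent))))
  ... | inj₂ h<f | _ = trans (*-≈0ˡ _ (K-head> z n m h<m₁)) (sym (*-≈0ˡ _ (reductionCoeff-≈0 h<f)))
    where
    h<m₁ : n zero ℕ.< m zero
    h<m₁ = ≡.subst (n zero ℕ.<_) (≡.sym m₁≡a+f) (ℕ.<-≤-trans h<f (ℕ.m≤n+m f _))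
    reductionCoeff-≈0 : n zero ℕ.< f → reductionCoeff z n f ≈ 0#
    reductionCoeff-≈0 h<f = *-≈0ˡ _ (*-≈0ˡ _ (*-≈0ˡ _ (*-≈0ˡ _ (*-≈0ˡ _ (qbinℕ-> _ _ h<f)))))

  module Collapse {s} (z : Fin (suc (suc s)) → Carrier) (n : Fin (suc (suc s)) → ℕ) (f : ℕ) where
    h : ℕ
    h = n zero
    n₂ : ℕ
    n₂ = n (suc zero)
    n₃ : ℕ
    n₃ = at (λ i → n (suc (suc i))) 0
    d : ℕ
    d = h ∸ n₂
    z₁ : Carrier
    z₁ = z zero
    z₂ : Carrier
    z₂ = z (suc zero)

    laterΦTerm : Fin s → Carrier
    laterΦTerm j = inv (pochℤ q (z (suc (suc j)) * q) (+ h ℤ.- + nxt n (suc (suc j))))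
                   * qbin q (+ n (suc (suc j))) (+ nxt n (suc (suc j)))

    prefixes*reducedΦ : AllGeneric z → Decreasing n → f ℕ.≤ d →
      prodFin (λ i → inv (poch q (z (suc i) * q) f)) * Φ (reducedZ z f) q (reducedN n f)
        ≈ (inv (pochℤ q (z₂ * q) (+ h ℤ.- + n₃)) * qbinℕ q (h ∸ f) n₃) * prodFin laterΦTerm
    prefixes*reducedΦ z-generic (n₂≤h , dec-tail) f≤d = begin
      (prefix₂ * prodFin prefix) * ((first′ * qbinℕ q (h ∸ f) n₃) * prodFin later′)
        ≈⟨ solve 5 (λ I₂ Π P B R → (I₂ :* Π) :* ((P :* B) :* R) := ((P :* I₂) :* B) :* (R :* Π)) refl
                   prefix₂ (prodFin prefix) first′ (qbinℕ q (h ∸ f) n₃) (prodFin later′) ⟩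
      ((first′ * prefix₂) * qbinℕ q (h ∸ f) n₃) * (prodFin later′ * prodFin prefix)
        ≈⟨ *-cong (*-congʳ (absorb z₂ (z-generic (suc zero)) n₃ (ℕ.≤-trans (proj₁ dec-tail) n₂≤h∸f)))
                  (trans (sym (prodFin-* later′ prefix)) (prodFin-cong later-absorb)) ⟩
      (inv (pochℤ q (z₂ * q) (+ h ℤ.- + n₃)) * qbinℕ q (h ∸ f) n₃) * prodFin laterΦTerm ∎
      where
      n₂≤h∸f : n₂ ℕ.≤ h ∸ f
      n₂≤h∸f = ≡.subst (ℕ._≤ h ∸ f) (ℕ.m∸[m∸n]≡n n₂≤h) (ℕ.∸-monoʳ-≤ h f≤d)
      prefix₂ = inv (poch q (z₂ * q) f)
      prefix : Fin s → Carrier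
      prefix j = inv (poch q (z (suc (suc j)) * q) f)
      first′ = inv (pochℤ q (z₂ * pow q f * q) (+ (h ∸ f) ℤ.- + n₃))
      later′ : Fin s → Carrier
      later′ j = inv (pochℤ q (z (suc (suc j)) * pow q f * q) (+ (h ∸ f) ℤ.- + nxt n (suc (suc j))))
                 * qbin q (+ n (suc (suc j))) (+ nxt n (suc (suc j)))
      absorb : ∀ x → Generic x → ∀ v → v ℕ.≤ h ∸ f →
        inv (pochℤ q (x * pow q f * q) (+ (h ∸ f) ℤ.- + v)) * inv (poch q (x * q) f) ≈ inv (pochℤ q (x * q) (+ h ℤ.- + v))
      absorb x x-generic v v≤h∸f =
        trans (inv-pochℤ-shift x f (h ∸ f) v x-generic v≤h∸f)
              (reflexive (≡.cong (λ t → inv (pochℤ q (x * q) (+ t ℤ.- + v))) (ℕ.m+[n∸m]≡n (ℕ.≤-trans f≤d (ℕ.m∸n≤m h n₂)))))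
      later-absorb : ∀ j → later′ j * prefix j ≈ laterΦTerm j
      later-absorb j = trans (solve 3 (λ a b c → (a :* b) :* c := (a :* c) :* b) refl _ _ _)
        (*-congʳ (absorb (z (suc (suc j))) (z-generic _) (nxt n (suc (suc j)))
                         (ℕ.≤-trans (decreasing-next≤head (λ i → n (suc i)) dec-tail (suc j)) n₂≤h∸f)))

    reductionCoeff*reducedΦ-rank≥3 : AllGeneric z → Decreasing n → f ℕ.≤ d →
      reductionCoeff z n f * Φ (reducedZ z f) q (reducedN n f) ≈ Φ z q n * kernelTerm d z₁ f
    reductionCoeff*reducedΦ-rank≥3 z-generic dec-n@(n₂≤h , n₃≤n₂ , _) f≤d = begin
      (hf * Z * S * ip * reductionBinom n f * prodFin (λ i → inv (poch q (z (suc i) * q) f))) * Φ′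
        ≈⟨ *-assoc _ _ _ ⟩
      (hf * Z * S * ip * reductionBinom n f) * (prodFin (λ i → inv (poch q (z (suc i) * q) f)) * Φ′)
        ≈⟨ *-cong (*-congˡ (reflexive binom≡)) (prefixes*reducedΦ z-generic dec-n f≤d) ⟩
      (hf * Z * S * ip * Bℕ) * ((A₂ * qbinℕ q (h ∸ f) n₃) * prodFin laterΦTerm)
        ≈⟨ solve 8 (λ hf Z S ip B A₂ Q Π → (hf :* Z :* S :* ip :* B) :* ((A₂ :* Q) :* Π)
                                        := ip :* (hf :* B :* Q) :* (Z :* S :* A₂ :* Π)) refl
                   hf Z S ip Bℕ A₂ (qbinℕ q (h ∸ f) n₃) (prodFin laterΦTerm) ⟩
      ip * (hf * Bℕ * qbinℕ q (h ∸ f) n₃) * (Z * S * A₂ * prodFin laterΦTerm)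
        ≈⟨ *-congʳ (*-cong (sym (inv-poch*tail z₁ f d (z-generic zero) f≤d)) (qbinℕ-triple h n₂ n₃ f n₃≤n₂ f≤d n₂≤h)) ⟩
      (ipd * tail) * (qbinℕ q h n₂ * qbinℕ q n₂ n₃ * qbinℕ q d f) * (Z * S * A₂ * prodFin laterΦTerm)
        ≈⟨ solve 9 (λ ipd tail H₂ Q₂₃ D Z S A₂ Π → (ipd :* tail) :* (H₂ :* Q₂₃ :* D) :* (Z :* S :* A₂ :* Π)
                                              := ((ipd :* H₂) :* ((A₂ :* Q₂₃) :* Π)) :* (D :* (Z :* S :* tail))) refl
                   ipd tail (qbinℕ q h n₂) (qbinℕ q n₂ n₃) (qbinℕ q d f) Z S A₂ (prodFin laterΦTerm) ⟩
      ((ipd * qbinℕ q h n₂) * ((A₂ * qbinℕ q n₂ n₃) * prodFin laterΦTerm)) * (qbinℕ q d f * (Z * S * tail))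
        ≡⟨ ≡.cong (λ t → ((inv (pochℤ q (z₁ * q) t) * qbinℕ q h n₂) * ((A₂ * qbinℕ q n₂ n₃) * prodFin laterΦTerm))
                         * (qbinℕ q d f * (Z * S * tail)))
                  (≡.sym (+m-+n≡+[m∸n] h n₂ n₂≤h)) ⟩
      Φ z q n * kernelTerm d z₁ f ∎
      where
      hf = qbinℕ q h f
      Z = pow z₁ f
      S = pow q (f ℕ.* f)
      ip = inv (poch q (z₁ * q) f)
      ipd = inv (poch q (z₁ * q) d)
      tail = poch q (z₁ * pow q (suc f)) (d ∸ f)
      A₂ = inv (pochℤ q (z₂ * q) (+ h ℤ.- + n₃))
      Φ′ = Φ (reducedZ z f) q (reducedN n f)
      Bℕ = qbinℕ q (h ∸ n₃ ∸ f) (n₂ ∸ n₃)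
      binom≡ : reductionBinom n f ≡ Bℕ
      binom≡ = ≡.cong₂ (qbin q)
        (≡.trans (≡.cong (ℤ._- + f) (+m-+n≡+[m∸n] h n₃ (ℕ.≤-trans n₃≤n₂ n₂≤h)))
                 (+m-+n≡+[m∸n] (h ∸ n₃) f (ℕ.≤-trans f≤d (ℕ.∸-monoʳ-≤ h n₃≤n₂))))
        (+m-+n≡+[m∸n] n₂ n₃ n₃≤n₂)

  reductionCoeff*reducedΦ-rank2 : ∀ (z : Fin 1 → Carrier) (n : Fin 1 → ℕ) f → AllGeneric z → f ℕ.≤ n zero →
    reductionCoeff z n f * Φ (reducedZ z f) q (reducedN n f) ≈ Φ z q n * kernelTerm (n zero) (z zero) f
  reductionCoeff*reducedΦ-rank2 z n f z-generic f≤h = begin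
    (hf * Z * S * ip * reductionBinom n f * 1#) * 1#
      ≈⟨ trans (*-identityʳ _) (trans (*-identityʳ _) (*-congˡ binom≈1)) ⟩
    hf * Z * S * ip * 1#
      ≈⟨ solve 4 (λ hf Z S ip → hf :* Z :* S :* ip :* con (+ 1) := ip :* (hf :* (Z :* S))) refl hf Z S ip ⟩
    ip * (hf * (Z * S))
      ≈⟨ *-congʳ (sym (inv-poch*tail z₁ f h (z-generic zero) f≤h)) ⟩
    (inv (poch q (z₁ * q) h) * tail) * (hf * (Z * S))
      ≈⟨ solve 5 (λ a b hf Z S → (a :* b) :* (hf :* (Z :* S)) := ((a :* con (+ 1)) :* con (+ 1)) :* (hf :* (Z :* S :* b))) refl _ _ hf Z S ⟩
    ((inv (poch q (z₁ * q) h) * 1#) * 1#) * (hf * (Z * S * tail))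
      ≈⟨ *-congʳ (*-congʳ (*-cong (reflexive (≡.cong (λ t → inv (pochℤ q (z₁ * q) t)) (≡.sym (ℤ.+-identityʳ (+ h)))))
                                  (sym (qbinℕ-0 h)))) ⟩
    Φ z q n * kernelTerm h z₁ f ∎
    where
    h = n zero
    z₁ = z zero
    hf = qbinℕ q h f
    Z = pow z₁ f
    S = pow q (f ℕ.* f)
    ip = inv (poch q (z₁ * q) f)
    tail = poch q (z₁ * pow q (suc f)) (h ∸ f)
    binom≈1 : reductionBinom n f ≈ 1#
    binom≈1 = trans (reflexive (≡.cong (λ t → qbin q t (+ 0)) (≡.trans (h-v-f≡[h∸f]-v h 0 f f≤h) (ℤ.+-identityʳ (+ (h ∸ f))))))
                    (qbinℕ-0 (h ∸ f))

  reductionBinom-≈0 : ∀ {s} (n : Fin (suc s) → ℕ) f → Decreasing n → at n 0 ∸ at n 1 ℕ.< f → reductionBinom n f ≈ 0#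
  reductionBinom-≈0 n f dec-n = qbin≈0 (at n 0) (at n 1) (at n 2) (decreasing-at2≤at1 n dec-n) (proj₁ dec-n)
    where
    qbin≈0 : ∀ h n₂ n₃ → n₃ ℕ.≤ n₂ → n₂ ℕ.≤ h → h ∸ n₂ ℕ.< f → qbin q (+ h ℤ.- + n₃ ℤ.- + f) (+ n₂ ℤ.- + n₃) ≈ 0#
    qbin≈0 h n₂ n₃ n₃≤n₂ n₂≤h h∸n₂<f with ℕ.≤-<-connex f (h ∸ n₃)
    ... | inj₁ f≤h∸n₃ = trans (reflexive (≡.cong₂ (qbin q) (≡.trans h-n₃-f (+m-+n≡+[m∸n] (h ∸ n₃) f f≤h∸n₃))
                                                            (+m-+n≡+[m∸n] n₂ n₃ n₃≤n₂)))
                              (qbinℕ-> _ _ (h∸n₃∸f<n₂∸n₃ h n₂ n₃ f n₃≤n₂ n₂≤h h∸n₂<f f≤h∸n₃))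
      where h-n₃-f = ≡.cong (ℤ._- + f) (+m-+n≡+[m∸n] h n₃ (ℕ.≤-trans n₃≤n₂ n₂≤h))
    ... | inj₂ h∸n₃<f = ≡.subst (λ t → qbin q t (+ n₂ ℤ.- + n₃) ≈ 0#) (≡.sym h-n₃-f) (qbin-top<0 _ (h ∸ n₃) f h∸n₃<f)
      where h-n₃-f = ≡.cong (ℤ._- + f) (+m-+n≡+[m∸n] h n₃ (ℕ.≤-trans n₃≤n₂ n₂≤h))

  reductionCoeff*reducedΦ : ∀ {s} (z : Fin (suc s) → Carrier) (n : Fin (suc s) → ℕ) f → AllGeneric z → Decreasing n →
    reductionCoeff z n f * Φ (reducedZ z f) q (reducedN n f) ≈ Φ z q n * kernelTerm (at n 0 ∸ at n 1) (z zero) f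
  reductionCoeff*reducedΦ z n f z-generic dec-n with ℕ.≤-<-connex f (at n 0 ∸ at n 1)
  reductionCoeff*reducedΦ {ℕ.zero} z n f z-generic dec-n | inj₁ f≤d = reductionCoeff*reducedΦ-rank2 z n f z-generic f≤d
  reductionCoeff*reducedΦ {suc s}  z n f z-generic dec-n | inj₁ f≤d = Collapse.reductionCoeff*reducedΦ-rank≥3 z n f z-generic dec-n f≤d
  reductionCoeff*reducedΦ z n f z-generic dec-n | inj₂ d<f =
    trans (*-≈0ˡ _ (*-≈0ˡ _ (*-≈0ʳ _ (reductionBinom-≈0 n f dec-n d<f))))
          (sym (*-≈0ʳ _ (*-≈0ˡ _ (qbinℕ-> _ _ d<f))))

  reductionCoeff-sum : ∀ {s} (z : Fin (suc s) → Carrier) (n : Fin (suc s) → ℕ) N → AllGeneric z → Decreasing n →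
    n zero ℕ.≤ N → sumTo N (λ f → reductionCoeff z n f * Φ (reducedZ z f) q (reducedN n f)) ≈ Φ z q n
  reductionCoeff-sum z n N z-generic dec-n h≤N = begin
    sumTo N (λ f → reductionCoeff z n f * Φ (reducedZ z f) q (reducedN n f))  ≈⟨ sumTo-cong N (λ f → reductionCoeff*reducedΦ z n f z-generic dec-n) ⟩
    sumTo N (λ f → Φ z q n * kernelTerm d (z zero) f)                         ≈⟨ sumTo-*ˡ N _ _ ⟩
    Φ z q n * sumTo N (kernelTerm d (z zero))                                 ≈⟨ *-congˡ (kernelTerm-sum d N (z zero) (ℕ.≤-trans (ℕ.m∸n≤m (n zero) (at n 1)) h≤N)) ⟩
    Φ z q n * 1#                                                              ≈⟨ *-identityʳ _ ⟩
    Φ z q n                                                                   ∎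
    where d = at n 0 ∸ at n 1

  reducedN-head≤ : ∀ {s} (n : Fin (suc s) → ℕ) f {N} → n zero ℕ.≤ N → at (reducedN n f) 0 ℕ.≤ N
  reducedN-head≤ {ℕ.zero} n f h≤N = ℕ.z≤n
  reducedN-head≤ {suc s}  n f h≤N = ℕ.≤-trans (ℕ.m∸n≤m (n zero) f) h≤N

  KΦ-cong : ∀ {s} (z : Fin s → Carrier) (n : Fin s → ℕ) {m m′ : Fin s → ℕ} → (∀ i → m i ≡ m′ i) →
    K z q n m * Φ z q m ≈ K z q n m′ * Φ z q m′
  KΦ-cong {s} z n {m} {m′} m≗m′ = *-cong (*-cong (reflexive (≡.cong (λ t → qbin q (+ at n 0) (+ t)) (at-cong m≗m′ 0)))
                                             (prodFin-cong (λ i → reflexive (cong₃ (KTerm i) (m≗m′ i) (next i) head))))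
                                     (prodFin-cong (λ i → reflexive (cong₃ (ΦTerm i) (m≗m′ i) (next i) head)))
    where
    head = at-cong m≗m′ 0
    next = λ i → at-cong m≗m′ (suc (toℕ i))
    KTerm : Fin s → ℕ → ℕ → ℕ → Carrier
    KTerm i mᵢ mᵢ₊₁ m₁ = zpow (z i) (+ mᵢ ℤ.- + mᵢ₊₁) * zpow q (+ mᵢ ℤ.* + mᵢ ℤ.- + mᵢ ℤ.* + mᵢ₊₁)
                            * qbin q (+ at n 0 ℤ.- + nxt n i ℤ.- + m₁ ℤ.+ + mᵢ) (+ n i ℤ.- + nxt n i)
    ΦTerm : Fin s → ℕ → ℕ → ℕ → Carrier
    ΦTerm i mᵢ mᵢ₊₁ m₁ = inv (pochℤ q (z i * q) (+ m₁ ℤ.- + mᵢ₊₁)) * qbin q (+ mᵢ) (+ mᵢ₊₁)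

  boxSum-suc : ∀ s N (g : (Fin (suc s) → ℕ) → Carrier) → (∀ {m m′} → (∀ i → m i ≡ m′ i) → g m ≈ g m′) →
    boxSum (suc s) N g ≈ sumTo N (λ j → boxSum s N (λ m → g (j Vector.∷ m)))
  boxSum-suc s N g g-cong = sumTo-cong N (λ j → boxSum-cong s N (λ m → g-cong (λ { zero → ≡.refl ; (suc i) → ≡.refl })))

  KΦ-boxSum : ∀ s (z : Fin s → Carrier) (n : Fin s → ℕ) N → AllGeneric z → at n 0 ℕ.≤ N →
    boxSum s N (λ m → K z q n m * Φ z q m) ≈ Φ z q n
  KΦ-boxSum ℕ.zero  z n N _ _ = trans (*-identityʳ _) (trans (*-identityʳ _) (qbinℕ-0 0))
  KΦ-boxSum (suc s) z n N z-generic h≤N with decreasing? n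
  ... | inj₂ (i , ascent) = trans (boxSum-0 (suc s) N (λ m → *-≈0ˡ (Φ z q m) (K-ascent z n m i ascent))) (sym (Φ-ascent z n i ascent))
  ... | inj₁ dec-n = begin
    boxSum (suc s) N summand
      ≈⟨ boxSum-suc s N summand (KΦ-cong z n) ⟩
    sumTo N (λ j → boxSum s N (λ m′ → summand (j Vector.∷ m′)))
      ≈⟨ sumTo-boxSum-comm s N N _ ⟩
    boxSum s N (λ m′ → sumTo N (λ j → summand (j Vector.∷ m′)))
      ≈⟨ boxSum-cong s N (λ m′ → sumTo-shift N (at m′ 0) _ (λ j → below (j Vector.∷ m′)) (λ j → above (j Vector.∷ m′))) ⟩
    boxSum s N (λ m′ → sumTo N (λ f → summand ((at m′ 0 ℕ.+ f) Vector.∷ m′)))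
      ≈⟨ sumTo-boxSum-comm s N N _ ⟨
    sumTo N (λ f → boxSum s N (λ m′ → summand ((at m′ 0 ℕ.+ f) Vector.∷ m′)))
      ≈⟨ sumTo-cong N (λ f → trans (boxSum-cong s N (λ m′ → KΦ-factor z n ((at m′ 0 ℕ.+ f) Vector.∷ m′) f z-generic dec-n ≡.refl)) (boxSum-*ˡ s N _ _)) ⟩
    sumTo N (λ f → reductionCoeff z n f * boxSum s N (λ m′ → K (reducedZ z f) q (reducedN n f) m′ * Φ (reducedZ z f) q m′))
      ≈⟨ sumTo-cong N (λ f → *-congˡ (KΦ-boxSum s (reducedZ z f) (reducedN n f) N (reduced-generic f) (reducedN-head≤ n f h≤N))) ⟩
    sumTo N (λ f → reductionCoeff z n f * Φ (reducedZ z f) q (reducedN n f))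
      ≈⟨ reductionCoeff-sum z n N z-generic dec-n h≤N ⟩
    Φ z q n ∎
    where
    summand : (Fin (suc s) → ℕ) → Carrier
    summand m = K z q n m * Φ z q m
    below : ∀ m → m zero ℕ.< at m 1 → summand m ≈ 0#
    below m m₁<m₂ = *-≈0ʳ (K z q n m) (Φ-ascent z m zero m₁<m₂)
    above : ∀ m → N ℕ.< m zero → summand m ≈ 0#
    above m N<m₁ = *-≈0ˡ (Φ z q m) (K-head> z n m (ℕ.≤-<-trans h≤N N<m₁))
    reduced-generic : ∀ f → AllGeneric (reducedZ z f)
    reduced-generic f i = generic-*qᶠ (z (suc i)) f (z-generic (suc i))

theorem8p2 : ∀ {c ℓ} (F : Field c ℓ) → let open FieldOps F in
    (r : ℕ) → 2 ≤ r →
    (z : Fin (r ∸ 1) → Carrier) (q : Carrier) →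
    ¬ (q ≈ 0#) → (∀ j → ¬ (pow q (suc j) ≈ 1#)) →
    (∀ i → ¬ (z i ≈ 0#)) → (∀ i (e : ℤ) → ¬ (z i * zpow q e ≈ 1#)) →
    (n : Fin (r ∸ 1) → ℕ) → (N : ℕ) → at n 0 ≤ N →
    boxSum (r ∸ 1) N (λ m → K z q n m * Φ z q m) ≈ Φ z q n
theorem8p2 F r _ z q _ q-notRootOfUnity _ zqᵉ≉1 n N n₁≤N =
  GenericQ.KΦ-boxSum F q q-notRootOfUnity (r ∸ 1) z n N (λ i k → zqᵉ≉1 i (+ suc k)) n₁≤N
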